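{- Let $T$ be a spider of order $n$. Let $m=\lfloor n/2\rfloor$, let $d_a=|c_{(n-a,a)}(T)|$ for $1\leq a\leq m$, and let $d(T)=(d_1,\dots,d_m)$. Then one of the following holds: (1) $d_1\geq d_2\geq\cdots\geq d_m\geq 0$ (so $d(T)$ is a partition, ignoring zero entries); (2) there is a number $t\leq m$ such that $d_1\geq\cdots\geq d_t=1$, and moreover $d_{t+1}=d_{t+2}=\cdots=d_{m-1}=2$ and $d_m\in\{1,2\}$. In case (1) let $\mu=d(T)$; in case (2) let $\mu$ be the partition obtained from $d(T)$ by replacing every entry $2$ after the $t$-th place by two entries $1$. Then $T=T_\lambda$ (up to isomorphism), where $\lambda$ is the conjugate partition of $\mu$.
   Context: A spider is a tree with exactly one vertex of degree $\geq 3$; it consists of edge-disjoint paths (legs) with a common endpoint. For a partition $\lambda\vdash n-1$ with at least 3 parts, $T_\lambda$ denotes the spider on $n$ vertices whose leg lengths (numbers of edges) are the parts of $\lambda$. For a graph $G$, ${\mathbf X}_G=\sum_\kappa\prod_{v}x_{\kappa(v)}$ over all proper colorings $\kappa:V(G)\to\{1,2,\dots\}$, and $c_\nu(G)$ denotes the coefficient of the power-sum symmetric function $p_\nu=\prod_j p_{\nu_j}$ (with $p_k=\sum_i x_i^k$) in ${\mathbf X}_G$; here $(n-a,a)$ is the two-part partition of $n$ with parts $n-a$ and $a$. The conjugate of a partition $\mu$ is the partition whose $i$-th part is $\#\{j : \mu_j\geq i\}$. -}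

module Defs where

open import Data.Nat as ℕ using (ℕ; zero; suc; _≤_; _<_; _∸_; _⊔_; _⊓_; _≡ᵇ_; _≤ᵇ_; _/_)
open import Data.Integer as ℤ using (ℤ; ∣_∣)
open import Data.Bool using (Bool; true; false; not; if_then_else_)
import Data.Bool
open import Data.List using (List; []; _∷_; _++_; map; concatMap; upTo; foldr; length; filter)
open import Data.Nat.ListAction using (sum)
open import Data.Product using (_×_; _,_; proj₁; proj₂; Σ)
open import Data.Sum using (_⊎_)
open import Relation.Binary.PropositionalEquality using (_≡_)
open import Data.List.Relation.Binary.Permutation.Propositional using (_↭_)

oneTo : ℕ → List ℕ
oneTo k = map suc (upTo k)

-- The spider T_λ with legs (list of leg lengths, in any order).
-- Vertices are 0 .. n-1 with n = 1 + sum legs; vertex 0 is the centre,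
-- and the leg with offset s and length l uses vertices s+1 .. s+l.

legEdges : ℕ → ℕ → List (ℕ × ℕ)
legEdges s zero = []
legEdges s (suc l) = (0 , suc s) ∷ map (λ j → (s ℕ.+ suc j , s ℕ.+ suc (suc j))) (upTo l)

spiderEdgesFrom : ℕ → List ℕ → List (ℕ × ℕ)
spiderEdgesFrom s [] = []
spiderEdgesFrom s (l ∷ ls) = legEdges s l ++ spiderEdgesFrom (s ℕ.+ l) ls

spiderEdges : List ℕ → List (ℕ × ℕ)
spiderEdges legs = spiderEdgesFrom 0 legs

order : List ℕ → ℕ
order legs = suc (sum legs)

-- Colourings with colours 0 .. k-1 of vertices 0 .. len-1, as lists.

at : List ℕ → ℕ → ℕ
at [] _ = 0
at (c ∷ cs) zero = c
at (c ∷ cs) (suc v) = at cs v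

colourings : ℕ → ℕ → List (List ℕ)
colourings k zero = [] ∷ []
colourings k (suc len) = concatMap (λ c → map (c ∷_) (colourings k len)) (upTo k)

proper : List (ℕ × ℕ) → List ℕ → Bool
proper E κ = foldr Data.Bool._∧_ true (map (λ e → not (at κ (proj₁ e) ≡ᵇ at κ (proj₂ e))) E)

sumℤ : List ℤ → ℤ
sumℤ = foldr ℤ._+_ (ℤ.+ 0)

prodℤ : List ℤ → ℤ
prodℤ = foldr ℤ._*_ (ℤ.+ 1)

-- The chromatic symmetric function X_G of the graph with vertex set
-- {0..n-1} and edge list E, specialised to the n variables x 0 .. x (n-1)
-- (X_G is homogeneous of degree n, so this specialisation loses nothing).
chromX : ℕ → List (ℕ × ℕ) → (ℕ → ℤ) → ℤ
chromX n E x = sumℤ (map (λ κ → if proper E κ then prodℤ (map x κ) else ℤ.+ 0) (colourings n n))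

powerSum : ℕ → ℕ → (ℕ → ℤ) → ℤ
powerSum n k x = sumℤ (map (λ i → x i ℤ.^ k) (upTo n))

pν : ℕ → List ℕ → (ℕ → ℤ) → ℤ
pν n ν x = prodℤ (map (λ k → powerSum n k x) ν)

-- Partitions of n (weakly decreasing lists of positive parts).

-- partsLE f n k : partitions of n with all parts ≤ k (fuel f ≥ n)
partsLE : ℕ → ℕ → ℕ → List (List ℕ)
partsLE _ zero _ = [] ∷ []
partsLE zero (suc n) _ = []
partsLE (suc f) (suc n) k =
  concatMap (λ j → map (j ∷_) (partsLE f (suc n ∸ j) j)) (oneTo (k ⊓ suc n))

partitions : ℕ → List (List ℕ)
partitions n = partsLE n n n

-- c is a p-expansion of X_G (the coefficient of p_ν is c ν, ν ⊢ n);
-- as polynomial identity in n variables over ℤ (checked at all points).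
IsPowerSumExpansion : ℕ → List (ℕ × ℕ) → (List ℕ → ℤ) → Set
IsPowerSumExpansion n E c =
  (x : ℕ → ℤ) → chromX n E x ≡ sumℤ (map (λ ν → c ν ℤ.* pν n ν x) (partitions n))

maxℕ : List ℕ → ℕ
maxℕ = foldr _⊔_ 0

conjugate : List ℕ → List ℕ
conjugate μ = map (λ i → length (filter (λ a → i ℕ.≤? a) μ)) (oneTo (maxℕ μ))

dval : ℕ → (List ℕ → ℤ) → ℕ → ℕ
dval n c a = ∣ c ((n ∸ a) ∷ a ∷ []) ∣

Case1 : ℕ → (ℕ → ℕ) → Set
Case1 m d = (i j : ℕ) → 1 ≤ i → i ≤ j → j ≤ m → d j ≤ d i

Case2 : ℕ → (ℕ → ℕ) → ℕ → Set
Case2 m d t =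
  (1 ≤ t) × (t ≤ m)
  × ((i j : ℕ) → 1 ≤ i → i ≤ j → j ≤ t → d j ≤ d i)
  × (d t ≡ 1)
  × ((i : ℕ) → t < i → i < m → d i ≡ 2)
  × (d m ≡ 1 ⊎ d m ≡ 2)

mu1 : ℕ → (ℕ → ℕ) → List ℕ
mu1 m d = map d (oneTo m)

mu2 : ℕ → (ℕ → ℕ) → ℕ → List ℕ
mu2 m d t = map d (oneTo t)
  ++ concatMap (λ i → if d i ≡ᵇ 2 then 1 ∷ 1 ∷ [] else d i ∷ [])
               (map (λ j → t ℕ.+ j) (oneTo (m ∸ t)))

IsSpiderLegs : List ℕ → Set
IsSpiderLegs legs = (3 ≤ length legs) × Data.List.Relation.Unary.All.All (1 ≤_) legs
  where import Data.List.Relation.Unary.All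

module Submission where

-- Colour the centre first. For a fixed centre colour with weight z, a leg of length l contributes
-- f_l(z), where f_(l+1)(z) = ∑_d x_d f_l(x_d) - z f_l(z); so f_l is a polynomial in z with
-- power-sum coefficients and X_T becomes an explicit signed combination of the p_ν. In it the
-- coefficient of p_(n-a,a) is ±(#legs ≥ a + #legs ≥ n-a), the second count omitted when a = n-a,
-- and the p_ν (|ν| ≤ N) are linearly independent as functions on ℤ^N, so every expansion has
-- d_a equal to this count. At most one leg L exceeds n/2. Without one, d_a = #legs ≥ a, whose
-- conjugate is the multiset of legs. With one, d_a = #legs ≥ a for a ≤ t = n-1-L, and
-- d_a = 1 + [a ≠ n-a] for t < a ≤ n/2; this is case (2), and splitting the 2s into 1s
-- accounts for the parts of L beyond t.

open import Algebra.Bundles using (CommutativeMonoid)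
open import Data.Bool using (Bool; true; false; T; if_then_else_; not; _∧_)
import Data.Bool.Properties as Boolₚ
open import Data.Empty using (⊥-elim)
open import Data.Integer using (ℤ; +_; -_; 0ℤ; 1ℤ; ∣_∣; _+_; _*_; _-_; _^_)
import Data.Integer.Properties as ℤₚ
open import Data.Integer.Tactic.RingSolver using (solve-∀)
open import Data.List using (List; []; _∷_; _++_; map; concatMap; foldr; length; upTo; applyUpTo; replicate; reverse; filter; _∷ʳ_)
open import Data.List.Membership.Propositional using (find)
open import Data.List.Membership.Propositional.Properties using (∈-∃++)
import Data.List.Properties as Listₚ
open import Data.List.Relation.Binary.Permutation.Propositional using (_↭_; prep; ↭-sym; ↭-trans; ↭⇒↭ₛ)
open import Data.List.Relation.Binary.Permutation.Propositional.Properties using (All-resp-↭; ↭-length; ↭-reverse; shift)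
import Data.List.Relation.Binary.Permutation.Propositional.Properties as Permₚ
open import Data.List.Relation.Binary.Permutation.Setoid.Properties using (foldr-commMonoid)
open import Data.List.Relation.Unary.All as All using (All; []; _∷_)
import Data.List.Relation.Unary.All.Properties as Allₚ
open import Data.List.Relation.Unary.AllPairs using (AllPairs; []; _∷_; allPairs?)
open import Data.List.Relation.Unary.Any using (any?)
open import Data.List.Relation.Unary.Linked.Properties using (Linked⇒AllPairs)
open import Data.Nat as ℕ using (ℕ; zero; suc; _≤_; _<_; _≥_; _∸_; _⊓_; z≤n; s≤s; _≡ᵇ_; _<ᵇ_; _≤ᵇ_; _!; _/_; _≟_; _≤?_; _<?_)
open import Data.Nat.Divisibility using (_∣_; ∣-trans; m≤n⇒m!∣n!; m∣m*n)
open import Data.Nat.DivMod using (_%_; m*[n/m]≡n; m≡m%n+[m/n]*n; m%n<n)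
open import Data.Nat.ListAction using (sum)
open import Data.Nat.ListAction.Properties using (sum-++; sum-↭)
import Data.Nat.Properties as ℕₚ
open import Data.Nat.Tactic.RingSolver using () renaming (solve-∀ to solve-∀ℕ)
open import Data.Product using (_×_; _,_; proj₁; proj₂; Σ; map₁; map₂)
open import Data.Sum using (_⊎_; inj₁; inj₂)
open import Function using (_∘_; id)
open import Relation.Binary.Definitions using (tri<; tri≈; tri>)
open import Relation.Binary.Properties.DecTotalOrder ℕₚ.≤-decTotalOrder using (≥-decTotalOrder)
open import Relation.Binary.PropositionalEquality
open import Relation.Nullary using (¬_; Dec; does; yes; no)
open import Relation.Nullary.Decidable using (dec-true; dec-false)
open import Data.List.Sort.InsertionSort.Base ≥-decTotalOrder using (sort)
open import Data.List.Sort.InsertionSort.Properties ≥-decTotalOrder using (sort-↭; sort-↗)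

open import Defs

∑ : {A : Set} → List A → (A → ℤ) → ℤ
∑ [] f = 0ℤ
∑ (a ∷ as) f = f a + ∑ as f

syntax ∑ xs (λ a → e) = ∑[ a ∈ xs ] e

module _ {A : Set} where

  ∑-++ : (xs ys : List A) (f : A → ℤ) → ∑ (xs ++ ys) f ≡ ∑ xs f + ∑ ys f
  ∑-++ [] ys f = sym (ℤₚ.+-identityˡ _)
  ∑-++ (x ∷ xs) ys f = trans (cong (_+_ (f x)) (∑-++ xs ys f)) (sym (ℤₚ.+-assoc (f x) _ _))

  ∑-cong : (xs : List A) {f g : A → ℤ} → (∀ a → f a ≡ g a) → ∑ xs f ≡ ∑ xs g
  ∑-cong [] h = refl
  ∑-cong (x ∷ xs) h = cong₂ _+_ (h x) (∑-cong xs h)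

  ∑-cong-All : {xs : List A} {f g : A → ℤ} → All (λ a → f a ≡ g a) xs → ∑ xs f ≡ ∑ xs g
  ∑-cong-All [] = refl
  ∑-cong-All (p ∷ ps) = cong₂ _+_ p (∑-cong-All ps)

  ∑-zero-All : {xs : List A} {f : A → ℤ} → All (λ a → f a ≡ 0ℤ) xs → ∑ xs f ≡ 0ℤ
  ∑-zero-All [] = refl
  ∑-zero-All (p ∷ ps) = cong₂ _+_ p (∑-zero-All ps)

  ∑-zero : (xs : List A) {f : A → ℤ} → (∀ a → f a ≡ 0ℤ) → ∑ xs f ≡ 0ℤ
  ∑-zero xs h = ∑-zero-All {xs = xs} (All.tabulate (λ {a} _ → h a))

  ∑-+ : (xs : List A) (f g : A → ℤ) → ∑[ a ∈ xs ] (f a + g a) ≡ ∑ xs f + ∑ xs g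
  ∑-+ [] f g = refl
  ∑-+ (x ∷ xs) f g = trans (cong (_+_ (f x + g x)) (∑-+ xs f g)) (interchange (f x) (g x) (∑ xs f) (∑ xs g))
    where
    interchange : ∀ a b c d → a + b + (c + d) ≡ a + c + (b + d)
    interchange = solve-∀

  ∑-*ˡ : (xs : List A) (c : ℤ) (f : A → ℤ) → ∑[ a ∈ xs ] (c * f a) ≡ c * ∑ xs f
  ∑-*ˡ [] c f = sym (ℤₚ.*-zeroʳ c)
  ∑-*ˡ (x ∷ xs) c f = trans (cong (_+_ (c * f x)) (∑-*ˡ xs c f)) (sym (ℤₚ.*-distribˡ-+ c (f x) _))

  ∑-*ʳ : (xs : List A) (c : ℤ) (f : A → ℤ) → ∑[ a ∈ xs ] (f a * c) ≡ ∑ xs f * c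
  ∑-*ʳ xs c f = trans (∑-cong xs (λ a → ℤₚ.*-comm (f a) c)) (trans (∑-*ˡ xs c f) (ℤₚ.*-comm c (∑ xs f)))

  ∑-neg : (xs : List A) (f : A → ℤ) → ∑[ a ∈ xs ] (- f a) ≡ - ∑ xs f
  ∑-neg [] f = refl
  ∑-neg (x ∷ xs) f = trans (cong (_+_ (- f x)) (∑-neg xs f)) (sym (ℤₚ.neg-distrib-+ (f x) _))

  sumℤ-map : (xs : List A) (f : A → ℤ) → sumℤ (map f xs) ≡ ∑ xs f
  sumℤ-map [] f = refl
  sumℤ-map (x ∷ xs) f = cong (_+_ (f x)) (sumℤ-map xs f)

module _ {A B : Set} where

  ∑-map : (g : A → B) (xs : List A) (f : B → ℤ) → ∑ (map g xs) f ≡ ∑ xs (f ∘ g)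
  ∑-map g [] f = refl
  ∑-map g (x ∷ xs) f = cong (_+_ (f (g x))) (∑-map g xs f)

  ∑-concatMap : (g : A → List B) (xs : List A) (f : B → ℤ) →
    ∑ (concatMap g xs) f ≡ ∑[ a ∈ xs ] ∑ (g a) f
  ∑-concatMap g [] f = refl
  ∑-concatMap g (x ∷ xs) f = trans (∑-++ (g x) (concatMap g xs) f) (cong (_+_ (∑ (g x) f)) (∑-concatMap g xs f))

  ∑-swap : (xs : List A) (ys : List B) (f : A → B → ℤ) →
    ∑[ a ∈ xs ] ∑ ys (f a) ≡ ∑[ b ∈ ys ] ∑[ a ∈ xs ] f a b
  ∑-swap [] ys f = sym (∑-zero ys (λ _ → refl))
  ∑-swap (x ∷ xs) ys f =
    trans (cong (_+_ (∑ ys (f x))) (∑-swap xs ys f)) (sym (∑-+ ys (f x) (λ b → ∑[ a ∈ xs ] f a b)))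

prodℤ-++ : (xs ys : List ℤ) → prodℤ (xs ++ ys) ≡ prodℤ xs * prodℤ ys
prodℤ-++ [] ys = sym (ℤₚ.*-identityˡ _)
prodℤ-++ (x ∷ xs) ys = trans (cong (x *_) (prodℤ-++ xs ys)) (sym (ℤₚ.*-assoc x _ _))

if-*ˡ : ∀ (b : Bool) z x → z * (if b then x else 0ℤ) ≡ (if b then z * x else 0ℤ)
if-*ˡ true z x = refl
if-*ˡ false z x = ℤₚ.*-zeroʳ z

if-*ʳ : ∀ (b : Bool) x z → (if b then x else 0ℤ) * z ≡ (if b then x * z else 0ℤ)
if-*ʳ true x z = refl
if-*ʳ false x z = ℤₚ.*-zeroˡ z

if-same : ∀ (b : Bool) (z : ℤ) → (if b then z else z) ≡ z
if-same true z = refl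
if-same false z = refl

≡ᵇ-true : ∀ {a b} → a ≡ b → (a ≡ᵇ b) ≡ true
≡ᵇ-true {a} {b} = dec-true (a ≟ b)

≡ᵇ-false : ∀ {a b} → ¬ a ≡ b → (a ≡ᵇ b) ≡ false
≡ᵇ-false {a} {b} = dec-false (a ≟ b)

≡ᵇ-refl : ∀ a → (a ≡ᵇ a) ≡ true
≡ᵇ-refl a = ≡ᵇ-true {a} refl

≡ᵇ-true⁻¹ : ∀ {a b} → (a ≡ᵇ b) ≡ true → a ≡ b
≡ᵇ-true⁻¹ {a} {b} e = ℕₚ.≡ᵇ⇒≡ a b (subst T (sym e) _)

≤ᵇ-true : ∀ {a b} → a ≤ b → (a ≤ᵇ b) ≡ true
≤ᵇ-true {a} {b} = dec-true (a ≤? b)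

≤ᵇ-false : ∀ {a b} → ¬ a ≤ b → (a ≤ᵇ b) ≡ false
≤ᵇ-false {a} {b} = dec-false (a ≤? b)

<ᵇ-true : ∀ {a b} → a < b → (a <ᵇ b) ≡ true
<ᵇ-true {a} {b} = dec-true (a <? b)

<ᵇ-false : ∀ {a b} → ¬ a < b → (a <ᵇ b) ≡ false
<ᵇ-false {a} {b} = dec-false (a <? b)

-- Polynomials vanishing on the positive integers

Poly : Set
Poly = List (ℕ × ℤ)

evalPoly : Poly → ℤ → ℤ
evalPoly p y = ∑[ t ∈ p ] (proj₂ t * y ^ proj₁ t)

coeff : Poly → ℕ → ℤ
coeff p e = ∑[ t ∈ p ] (if proj₁ t ≡ᵇ e then proj₂ t else 0ℤ)

lowerTerm : ℕ × ℤ → ℕ × ℤ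
lowerTerm (zero , c) = (0 , 0ℤ)
lowerTerm (suc e , c) = (e , c)

quotX : Poly → Poly
quotX = map lowerTerm

evalPoly-quotX : ∀ p y → evalPoly p y ≡ coeff p 0 + y * evalPoly (quotX p) y
evalPoly-quotX p y = begin
  evalPoly p y
    ≡⟨ ∑-cong p split ⟩
  ∑[ t ∈ p ] ((if proj₁ t ≡ᵇ 0 then proj₂ t else 0ℤ) + y * term (lowerTerm t))
    ≡⟨ ∑-+ p _ _ ⟩
  coeff p 0 + ∑[ t ∈ p ] (y * term (lowerTerm t))
    ≡⟨ cong (_+_ (coeff p 0)) (trans (∑-*ˡ p y _) (cong (y *_) (sym (∑-map lowerTerm p term)))) ⟩
  coeff p 0 + y * evalPoly (quotX p) y ∎
  where
  open ≡-Reasoning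
  term : ℕ × ℤ → ℤ
  term t = proj₂ t * y ^ proj₁ t
  split : ∀ t → term t ≡ (if proj₁ t ≡ᵇ 0 then proj₂ t else 0ℤ) + y * term (lowerTerm t)
  split (zero , c) = lemma c y
    where
    lemma : ∀ c y → c * 1ℤ ≡ c + y * (0ℤ * 1ℤ)
    lemma = solve-∀
  split (suc e , c) = lemma c y (y ^ e)
    where
    lemma : ∀ c y q → c * (y * q) ≡ 0ℤ + y * (c * q)
    lemma = solve-∀

coeff-quotX : ∀ p e → coeff (quotX p) e ≡ coeff p (suc e)
coeff-quotX p e = trans (∑-map lowerTerm p _) (∑-cong p lowered)
  where
  lowered : ∀ t → (if proj₁ (lowerTerm t) ≡ᵇ e then proj₂ (lowerTerm t) else 0ℤ)
                ≡ (if proj₁ t ≡ᵇ suc e then proj₂ t else 0ℤ)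
  lowered (zero , c) with 0 ≡ᵇ e
  ... | true = refl
  ... | false = refl
  lowered (suc e′ , c) = refl

m≡[1+m]*k⇒m≡0 : ∀ {m k} → m ≡ suc m ℕ.* k → m ≡ 0
m≡[1+m]*k⇒m≡0 {m} {zero} eq = trans eq (ℕₚ.*-zeroʳ m)
m≡[1+m]*k⇒m≡0 {m} {suc k} eq = ⊥-elim (ℕₚ.<-irrefl eq (ℕₚ.m≤m*n (suc m) (suc k)))

-- c is divisible by 1 + |c|, so it vanishes.
c+[1+∣c∣]*r≡0⇒c≡0 : ∀ c r → c + (+ suc ∣ c ∣) * r ≡ 0ℤ → c ≡ 0ℤ
c+[1+∣c∣]*r≡0⇒c≡0 c r eq = ℤₚ.∣i∣≡0⇒i≡0 (m≡[1+m]*k⇒m≡0 (begin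
  ∣ c ∣                    ≡⟨ cong ∣_∣ c≡-N*r ⟩
  ∣ - N*r ∣                ≡⟨ ℤₚ.∣-i∣≡∣i∣ N*r ⟩
  ∣ N*r ∣                  ≡⟨ ℤₚ.abs-* (+ suc ∣ c ∣) r ⟩
  suc ∣ c ∣ ℕ.* ∣ r ∣     ∎))
  where
  open ≡-Reasoning
  N*r = (+ suc ∣ c ∣) * r
  c≡-N*r : c ≡ - N*r
  c≡-N*r = begin
    c                ≡⟨ cancel c N*r ⟩
    c + N*r - N*r    ≡⟨ cong (_- N*r) eq ⟩
    0ℤ - N*r         ≡⟨ ℤₚ.+-identityˡ (- N*r) ⟩
    - N*r            ∎
    where
    cancel : ∀ a b → a ≡ a + b - b
    cancel = solve-∀

vanishing⇒coeff≡0 : ∀ p → (∀ y → evalPoly p (+ suc y) ≡ 0ℤ) → ∀ e → coeff p e ≡ 0ℤ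
vanishing⇒coeff≡0 p hyp zero = c+[1+∣c∣]*r≡0⇒c≡0 (coeff p 0) (evalPoly (quotX p) (+ suc ∣ coeff p 0 ∣))
  (trans (sym (evalPoly-quotX p _)) (hyp _))
vanishing⇒coeff≡0 p hyp (suc e) = trans (sym (coeff-quotX p e)) (vanishing⇒coeff≡0 (quotX p) quotX-vanishing e)
  where
  quotX-vanishing : ∀ y → evalPoly (quotX p) (+ suc y) ≡ 0ℤ
  quotX-vanishing y = ℤₚ.*-cancelˡ-≡ (+ suc y) _ _ (begin
    Q                      ≡⟨ ℤₚ.+-identityˡ Q ⟨
    0ℤ + Q                 ≡⟨ cong (_+ Q) (vanishing⇒coeff≡0 p hyp 0) ⟨
    coeff p 0 + Q          ≡⟨ evalPoly-quotX p (+ suc y) ⟨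
    evalPoly p (+ suc y)   ≡⟨ hyp y ⟩
    0ℤ                     ≡⟨ ℤₚ.*-zeroʳ (+ suc y) ⟨
    + suc y * 0ℤ           ∎)
    where
    open ≡-Reasoning
    Q = + suc y * evalPoly (quotX p) (+ suc y)

-- Linear independence of products of power sums

splits : List ℕ → List (List ℕ × List ℕ)
splits [] = ([] , []) ∷ []
splits (a ∷ l) = map (map₁ (a ∷_)) (splits l) ++ map (map₂ (a ∷_)) (splits l)

∑-splits-∷ : ∀ a l (f : List ℕ × List ℕ → ℤ) → ∑ (splits (a ∷ l)) f ≡
  ∑[ p ∈ splits l ] f (a ∷ proj₁ p , proj₂ p) + ∑[ p ∈ splits l ] f (proj₁ p , a ∷ proj₂ p)
∑-splits-∷ a l f = trans (∑-++ (map _ (splits l)) _ f) (cong₂ _+_ (∑-map _ (splits l) f) (∑-map _ (splits l) f))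

All-splits-∷ : ∀ {P : List ℕ × List ℕ → Set} a l →
  All (λ p → P (a ∷ proj₁ p , proj₂ p)) (splits l) → All (λ p → P (proj₁ p , a ∷ proj₂ p)) (splits l) →
  All P (splits (a ∷ l))
All-splits-∷ a l left right = Allₚ.++⁺ (Allₚ.map⁺ left) (Allₚ.map⁺ right)

splits-All : ∀ {P : ℕ → Set} {ν} → All P ν → All (λ p → All P (proj₁ p) × All P (proj₂ p)) (splits ν)
splits-All [] = ([] , []) ∷ []
splits-All {ν = a ∷ l} (pa ∷ pl) =
  All-splits-∷ a l (All.map (map₁ (pa ∷_)) (splits-All pl)) (All.map (map₂ (pa ∷_)) (splits-All pl))

Asc : List ℕ → Set
Asc = AllPairs _≤_

splits-Asc : ∀ {ν} → Asc ν → All (λ p → Asc (proj₁ p) × Asc (proj₂ p)) (splits ν)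
splits-Asc [] = ([] , []) ∷ []
splits-Asc {a ∷ l} (a≤l ∷ asc) = All-splits-∷ a l
  (All.zipWith (λ (h , g) → (proj₁ g ∷ proj₁ h) , proj₂ h) (splits-Asc asc , splits-All a≤l))
  (All.zipWith (λ (h , g) → proj₁ h , (proj₂ g ∷ proj₂ h)) (splits-Asc asc , splits-All a≤l))

splits-sum : ∀ ν → All (λ p → sum (proj₁ p) ℕ.+ sum (proj₂ p) ≡ sum ν) (splits ν)
splits-sum [] = refl ∷ []
splits-sum (a ∷ l) = All-splits-∷ a l
  (All.map (λ e → trans (ℕₚ.+-assoc a _ _) (cong (a ℕ.+_) e)) (splits-sum l))
  (All.map (λ {p} e → trans (sym (ℕₚ.+-assoc (sum (proj₁ p)) a _))
    (trans (cong (ℕ._+ sum (proj₂ p)) (ℕₚ.+-comm _ a)) (trans (ℕₚ.+-assoc a _ _) (cong (a ℕ.+_) e)))) (splits-sum l))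

_◂_ : ℤ → (ℕ → ℤ) → ℕ → ℤ
(y ◂ x) zero = y
(y ◂ x) (suc i) = x i

powerSum-◂ : ∀ N k y x → powerSum (suc N) k (y ◂ x) ≡ y ^ k + powerSum N k x
powerSum-◂ N k y x = cong (_+_ (y ^ k)) (cong sumℤ
  (trans (Listₚ.map-applyUpTo suc (λ i → (y ◂ x) i ^ k) N) (sym (Listₚ.map-upTo (λ i → x i ^ k) N))))

pν-◂ : ∀ N ν y x → pν (suc N) ν (y ◂ x) ≡ ∑[ p ∈ splits ν ] (y ^ sum (proj₁ p) * pν N (proj₂ p) x)
pν-◂ N [] y x = refl
pν-◂ N (a ∷ l) y x = begin
  powerSum (suc N) a (y ◂ x) * pν (suc N) l (y ◂ x)
    ≡⟨ cong₂ _*_ (powerSum-◂ N a y x) (pν-◂ N l y x) ⟩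
  (y ^ a + P) * ∑ (splits l) F
    ≡⟨ ℤₚ.*-distribʳ-+ (∑ (splits l) F) (y ^ a) P ⟩
  y ^ a * ∑ (splits l) F + P * ∑ (splits l) F
    ≡⟨ cong₂ _+_ (trans (sym (∑-*ˡ (splits l) (y ^ a) F)) (∑-cong (splits l) left))
                 (trans (sym (∑-*ˡ (splits l) P F)) (∑-cong (splits l) right)) ⟩
  ∑[ p ∈ splits l ] F (a ∷ proj₁ p , proj₂ p) + ∑[ p ∈ splits l ] F (proj₁ p , a ∷ proj₂ p)
    ≡⟨ ∑-splits-∷ a l F ⟨
  ∑ (splits (a ∷ l)) F ∎
  where
  open ≡-Reasoning
  P = powerSum N a x
  F : List ℕ × List ℕ → ℤ
  F p = y ^ sum (proj₁ p) * pν N (proj₂ p) x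
  left : ∀ p → y ^ a * F p ≡ F (a ∷ proj₁ p , proj₂ p)
  left p = trans (sym (ℤₚ.*-assoc (y ^ a) _ _))
    (cong (_* pν N (proj₂ p) x) (sym (ℤₚ.^-distribˡ-+-* y a (sum (proj₁ p)))))
  right : ∀ p → P * F p ≡ F (proj₁ p , a ∷ proj₂ p)
  right p = swap P (y ^ sum (proj₁ p)) (pν N (proj₂ p) x)
    where
    swap : ∀ a b c → a * (b * c) ≡ b * (a * c)
    swap = solve-∀

Combination : Set
Combination = List (ℤ × List ℕ)

⟦_⟧ : Combination → (List ℕ → ℤ) → ℤ
⟦ T ⟧ g = ∑[ t ∈ T ] (proj₁ t * g (proj₂ t))

⟦⟧-+ : ∀ T f g → ⟦ T ⟧ (λ ν → f ν + g ν) ≡ ⟦ T ⟧ f + ⟦ T ⟧ g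
⟦⟧-+ T f g = trans (∑-cong T (λ t → ℤₚ.*-distribˡ-+ (proj₁ t) _ _)) (∑-+ T _ _)

⟦⟧-*ˡ : ∀ T c f → ⟦ T ⟧ (λ ν → c * f ν) ≡ c * ⟦ T ⟧ f
⟦⟧-*ˡ T c f = trans (∑-cong T (λ t → swap (proj₁ t) c (f (proj₂ t)))) (∑-*ˡ T c _)
  where
  swap : ∀ a b c → a * (b * c) ≡ b * (a * c)
  swap = solve-∀

⟦⟧-cong-All : ∀ {P : List ℕ → Set} T {f g} → All (P ∘ proj₂) T → (∀ ν → P ν → f ν ≡ g ν) → ⟦ T ⟧ f ≡ ⟦ T ⟧ g
⟦⟧-cong-All T pT h = ∑-cong-All (All.map (λ {t} p → cong (proj₁ t *_) (h _ p)) pT)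

IsAscPartition≤ : ℕ → List ℕ → Set
IsAscPartition≤ N ν = Asc ν × All (1 ≤_) ν × sum ν ≤ N

Admissible : ℕ → Combination → Set
Admissible N T = All (IsAscPartition≤ N ∘ proj₂) T

PowerSumsIndependent : ℕ → Set
PowerSumsIndependent N = ∀ T → Admissible N T → (∀ x → ⟦ T ⟧ (λ ν → pν N ν x) ≡ 0ℤ) → ∀ g → ⟦ T ⟧ g ≡ 0ℤ

dropParts : ℕ → Combination → Combination
dropParts k = concatMap (λ t → concatMap (λ p → if sum (proj₁ p) ≡ᵇ k then (proj₁ t , proj₂ p) ∷ [] else [])
                                         (splits (proj₂ t)))

⟦dropParts⟧ : ∀ k T h → ⟦ dropParts k T ⟧ h ≡
  ⟦ T ⟧ (λ ν → ∑[ p ∈ splits ν ] (if sum (proj₁ p) ≡ᵇ k then h (proj₂ p) else 0ℤ))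
⟦dropParts⟧ k T h = trans (∑-concatMap _ T _) (∑-cong T (λ t →
  trans (∑-concatMap _ (splits (proj₂ t)) _)
  (trans (∑-cong (splits (proj₂ t)) (λ p → kept (sum (proj₁ p) ≡ᵇ k) (proj₁ t) (proj₂ p)))
         (∑-*ˡ (splits (proj₂ t)) (proj₁ t) _))))
  where
  kept : ∀ b w β → ∑ (if b then (w , β) ∷ [] else []) (λ s → proj₁ s * h (proj₂ s)) ≡ w * (if b then h β else 0ℤ)
  kept true w β = ℤₚ.+-identityʳ (w * h β)
  kept false w β = sym (ℤₚ.*-zeroʳ w)

dropParts-admissible : ∀ N k T → Admissible (suc N) T → Admissible N (dropParts (suc k) T)
dropParts-admissible N k [] [] = []
dropParts-admissible N k ((w , ν) ∷ T) ((asc , pos , ν≤) ∷ adm) =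
  Allₚ.++⁺ (leftovers (splits ν) (All.zip (splits-sum ν , All.zip (splits-Asc asc , splits-All pos))))
           (dropParts-admissible N k T adm)
  where
  leftovers : ∀ ps → All (λ p → (sum (proj₁ p) ℕ.+ sum (proj₂ p) ≡ sum ν) × (Asc (proj₁ p) × Asc (proj₂ p))
                                × (All (1 ≤_) (proj₁ p) × All (1 ≤_) (proj₂ p))) ps →
    Admissible N (concatMap (λ p → if sum (proj₁ p) ≡ᵇ suc k then (w , proj₂ p) ∷ [] else []) ps)
  leftovers [] [] = []
  leftovers (p ∷ ps) ((sp , (_ , asc₂) , (_ , pos₂)) ∷ rest) with sum (proj₁ p) ≡ᵇ suc k in eq
  ... | true = (asc₂ , pos₂ , bound) ∷ leftovers ps rest
    where
    bound : sum (proj₂ p) ≤ N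
    bound = ℕₚ.+-cancelˡ-≤ 1 _ N (ℕₚ.≤-trans (ℕₚ.+-monoˡ-≤ (sum (proj₂ p)) (ℕₚ.≤-trans (s≤s z≤n)
      (ℕₚ.≤-reflexive (sym (≡ᵇ-true⁻¹ eq))))) (ℕₚ.≤-trans (ℕₚ.≤-reflexive sp) ν≤))
  ... | false = leftovers ps rest

polyInFirst : ℕ → Combination → (ℕ → ℤ) → Poly
polyInFirst N T x = concatMap (λ t → map (λ p → (sum (proj₁ p) , proj₁ t * pν N (proj₂ p) x)) (splits (proj₂ t))) T

evalPoly-polyInFirst : ∀ N T x y → evalPoly (polyInFirst N T x) y ≡ ⟦ T ⟧ (λ ν → pν (suc N) ν (y ◂ x))
evalPoly-polyInFirst N T x y = trans (∑-concatMap _ T _) (∑-cong T term)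
  where
  term : ∀ t → ∑ (map (λ p → (sum (proj₁ p) , proj₁ t * pν N (proj₂ p) x)) (splits (proj₂ t))) (λ q → proj₂ q * y ^ proj₁ q)
             ≡ proj₁ t * pν (suc N) (proj₂ t) (y ◂ x)
  term (w , ν) = begin
    _ ≡⟨ ∑-map _ (splits ν) _ ⟩
    ∑[ p ∈ splits ν ] (w * pν N (proj₂ p) x * y ^ sum (proj₁ p))
      ≡⟨ ∑-cong (splits ν) (λ p → reorder w (pν N (proj₂ p) x) (y ^ sum (proj₁ p))) ⟩
    ∑[ p ∈ splits ν ] (w * (y ^ sum (proj₁ p) * pν N (proj₂ p) x))
      ≡⟨ ∑-*ˡ (splits ν) w _ ⟩
    w * ∑[ p ∈ splits ν ] (y ^ sum (proj₁ p) * pν N (proj₂ p) x)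
      ≡⟨ cong (w *_) (pν-◂ N ν y x) ⟨
    w * pν (suc N) ν (y ◂ x) ∎
    where
    open ≡-Reasoning
    reorder : ∀ a b c → a * b * c ≡ a * (c * b)
    reorder = solve-∀

coeff-polyInFirst : ∀ N T x k → coeff (polyInFirst N T x) k ≡ ⟦ dropParts k T ⟧ (λ ν → pν N ν x)
coeff-polyInFirst N T x k = trans (∑-concatMap _ T _) (trans (∑-cong T (λ t →
  trans (∑-map _ (splits (proj₂ t)) _) (trans (∑-cong (splits (proj₂ t)) (λ p → sym (if-*ˡ _ (proj₁ t) _)))
    (∑-*ˡ (splits (proj₂ t)) (proj₁ t) _))))
  (sym (⟦dropParts⟧ k T (λ ν → pν N ν x))))

isNil : List ℕ → ℤ
isNil [] = 1ℤ
isNil (_ ∷ _) = 0ℤ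

pν-zero : ∀ N {ν} → All (1 ≤_) ν → pν N ν (λ _ → 0ℤ) ≡ isNil ν
pν-zero N [] = refl
pν-zero N {suc a ∷ l} (_ ∷ _) = trans (cong (_* pν N l (λ _ → 0ℤ)) powerSum-at-0) (ℤₚ.*-zeroˡ (pν N l (λ _ → 0ℤ)))
  where
  powerSum-at-0 : powerSum N (suc a) (λ _ → 0ℤ) ≡ 0ℤ
  powerSum-at-0 = trans (sumℤ-map (upTo N) _) (∑-zero (upTo N) (λ _ → ℤₚ.*-zeroˡ (0ℤ ^ a)))

-- On ascending shapes the first part is the smallest one.
headBelow : ℕ → (List ℕ → ℤ) → List ℕ → ℤ
headBelow K g [] = 0ℤ
headBelow K g (a ∷ l) = if a <ᵇ K then g (a ∷ l) else 0ℤ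

headIs : ℕ → (List ℕ → ℤ) → List ℕ → ℤ
headIs k g [] = 0ℤ
headIs k g (a ∷ l) = if a ≡ᵇ k then g (a ∷ l) else 0ℤ

headIs-off : ∀ {k a l} g → ¬ a ≡ k → headIs k g (a ∷ l) ≡ 0ℤ
headIs-off g a≢k rewrite ≡ᵇ-false a≢k = refl

headBelow-suc : ∀ k g ν → headBelow (suc k) g ν ≡ headBelow k g ν + headIs k g ν
headBelow-suc k g [] = refl
headBelow-suc k g (a ∷ l) with ℕₚ.<-cmp a k
... | tri< a<k _ _ rewrite <ᵇ-true (ℕₚ.m<n⇒m<1+n a<k) | <ᵇ-true a<k | ≡ᵇ-false (ℕₚ.<⇒≢ a<k) =
  sym (ℤₚ.+-identityʳ _)
... | tri≈ _ refl _ rewrite <ᵇ-true (ℕₚ.n<1+n a) | <ᵇ-false (ℕₚ.<-irrefl {a} refl) | ≡ᵇ-refl a =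
  sym (ℤₚ.+-identityˡ _)
... | tri> _ _ k<a rewrite <ᵇ-false (ℕₚ.≤⇒≯ k<a) | <ᵇ-false (ℕₚ.<⇒≯ k<a) | ≡ᵇ-false (ℕₚ.<⇒≢ k<a ∘ sym) = refl

isSingleton : ℕ → List ℕ → Bool
isSingleton k (a ∷ []) = a ≡ᵇ k
isSingleton k _ = false

isSingleton-sum : ∀ k s → isSingleton k s ≡ true → (sum s ≡ᵇ k) ≡ true
isSingleton-sum k (a ∷ []) e rewrite ≡ᵇ-true⁻¹ {a} e | ℕₚ.+-identityʳ k = ≡ᵇ-refl k

sum-isSingleton : ∀ k s → All (suc k ≤_) s → (sum s ≡ᵇ suc k) ≡ true → isSingleton (suc k) s ≡ true
sum-isSingleton k (a ∷ []) _ e = trans (cong (_≡ᵇ suc k) (sym (ℕₚ.+-identityʳ a))) e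
sum-isSingleton k (a ∷ b ∷ s) (k<a ∷ k<b ∷ _) e = ⊥-elim (ℕₚ.<-irrefl refl (ℕₚ.<-≤-trans too-big (ℕₚ.≤-reflexive (≡ᵇ-true⁻¹ e))))
  where
  too-big : suc k < a ℕ.+ (b ℕ.+ sum s)
  too-big = ℕₚ.<-≤-trans (ℕₚ.m<m+n (suc k) (s≤s z≤n)) (ℕₚ.+-mono-≤ k<a (ℕₚ.≤-trans (ℕₚ.≤-trans (s≤s z≤n) k<b) (ℕₚ.m≤m+n b (sum s))))

isSingleton-∷-false : ∀ k b s → ¬ b ≡ k → isSingleton k (b ∷ s) ≡ false
isSingleton-∷-false k b [] b≢k = ≡ᵇ-false b≢k
isSingleton-∷-false k b (_ ∷ _) _ = refl

mult : ℕ → List ℕ → ℕ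
mult k [] = 0
mult k (a ∷ l) = (if a ≡ᵇ k then 1 else 0) ℕ.+ mult k l

mult-none : ∀ k {l} → All (λ b → ¬ b ≡ k) l → mult k l ≡ 0
mult-none k [] = refl
mult-none k {b ∷ l} (b≢k ∷ rest) rewrite ≡ᵇ-false b≢k = mult-none k rest

mult-head : ∀ a l → mult a (a ∷ l) ≡ suc (mult a l)
mult-head a l rewrite ≡ᵇ-refl a = refl

mult≤length : ∀ k l → mult k l ≤ length l
mult≤length k [] = z≤n
mult≤length k (a ∷ l) with a ≡ᵇ k
... | true = s≤s (mult≤length k l)
... | false = ℕₚ.m≤n⇒m≤1+n (mult≤length k l)

length≤sum : ∀ {l} → All (1 ≤_) l → length l ≤ sum l
length≤sum [] = z≤n
length≤sum (pa ∷ pl) = ℕₚ.+-mono-≤ pa (length≤sum pl)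

∑-splits-singleton-∷ : ∀ k a l (F : List ℕ → ℤ) →
  ∑[ p ∈ splits l ] (if isSingleton k (a ∷ proj₁ p) then F (proj₂ p) else 0ℤ) ≡ (if a ≡ᵇ k then F l else 0ℤ)
∑-splits-singleton-∷ k a [] F = ℤₚ.+-identityʳ _
∑-splits-singleton-∷ k a (b ∷ l) F = trans (∑-splits-∷ b l _)
  (trans (cong₂ _+_ (∑-zero (splits l) (λ _ → refl)) (∑-splits-singleton-∷ k a l (λ r → F (b ∷ r)))) (ℤₚ.+-identityˡ _))

∑-splits-singleton-none : ∀ k {l} (H : List ℕ × List ℕ → ℤ) → All (λ b → ¬ b ≡ k) l →
  ∑[ p ∈ splits l ] (if isSingleton k (proj₁ p) then H p else 0ℤ) ≡ 0ℤ
∑-splits-singleton-none k H [] = refl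
∑-splits-singleton-none k {b ∷ l} H (b≢k ∷ rest) = trans (∑-splits-∷ b l _) (trans (cong₂ _+_
  (∑-zero (splits l) (λ p → cong (λ c → if c then H (b ∷ proj₁ p , proj₂ p) else 0ℤ) (isSingleton-∷-false k b (proj₁ p) b≢k)))
  (∑-splits-singleton-none k (λ p → H (proj₁ p , b ∷ proj₂ p)) rest)) refl)

∑-splits-singleton-all : ∀ k {l} (F : List ℕ → ℤ) → All (k ≤_) l → Asc l →
  ∑[ p ∈ splits l ] (if isSingleton k (proj₁ p) then F (k ∷ proj₂ p) else 0ℤ) ≡ + mult k l * F l
∑-splits-singleton-all k F [] [] = refl
∑-splits-singleton-all k {b ∷ l} F (k≤b ∷ k≤l) (b≤l ∷ asc) with b ≟ k
... | yes refl = trans (∑-splits-∷ b l _) (trans (cong₂ _+_ (∑-splits-singleton-∷ k b l (λ r → F (k ∷ r)))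
  (∑-splits-singleton-all k (λ u → F (k ∷ u)) k≤l asc)) count-head)
  where
  count-head : (if b ≡ᵇ b then F (b ∷ l) else 0ℤ) + + mult b l * F (b ∷ l) ≡ + mult b (b ∷ l) * F (b ∷ l)
  count-head rewrite ≡ᵇ-refl b = trans (cong (_+ + mult b l * F (b ∷ l)) (sym (ℤₚ.*-identityˡ (F (b ∷ l)))))
    (sym (ℤₚ.*-distribʳ-+ (F (b ∷ l)) 1ℤ (+ mult b l)))
... | no b≢k = trans (∑-splits-∷ b l _) (trans (cong₂ _+_ (∑-splits-singleton-∷ k b l (λ r → F (k ∷ r)))
  (∑-splits-singleton-none k _ l≢k)) (trans (cong (λ c → (if c then F (k ∷ l) else 0ℤ) + 0ℤ) (≡ᵇ-false b≢k))
    (sym (trans (cong (λ z → + z * F (b ∷ l)) no-k) (ℤₚ.*-zeroˡ (F (b ∷ l)))))))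
  where
  k<b : k < b
  k<b = ℕₚ.≤∧≢⇒< k≤b (b≢k ∘ sym)
  l≢k : All (λ c → ¬ c ≡ k) l
  l≢k = All.map (λ b≤c e → ℕₚ.<-irrefl (sym e) (ℕₚ.<-≤-trans k<b b≤c)) b≤l
  no-k : mult k (b ∷ l) ≡ 0
  no-k rewrite ≡ᵇ-false b≢k = mult-none k l≢k

-- Removing one part k from an ascending ν and putting it back in front recovers ν exactly when
-- k is the smallest part; G is supported on such shapes.
∑-splits-singleton : ∀ k {ν} (G : List ℕ → ℤ) → (∀ b l → ¬ b ≡ k → G (b ∷ l) ≡ 0ℤ) → (∀ l → ¬ Asc l → G l ≡ 0ℤ) →
  Asc ν → ∑[ p ∈ splits ν ] (if isSingleton k (proj₁ p) then G (k ∷ proj₂ p) else 0ℤ) ≡ + mult k ν * G ν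
∑-splits-singleton k G _ _ [] = refl
∑-splits-singleton k {a ∷ l} G off-head off-asc (a≤l ∷ asc) with ℕₚ.<-cmp a k
... | tri< a<k _ _ = trans (∑-splits-∷ a l _) (trans (cong₂ _+_
      (trans (∑-splits-singleton-∷ k a l (λ r → G (k ∷ r))) (cong (λ c → if c then G (k ∷ l) else 0ℤ) (≡ᵇ-false (ℕₚ.<⇒≢ a<k))))
      (∑-zero (splits l) (λ p → trans (cong (λ z → if isSingleton k (proj₁ p) then z else 0ℤ) (off-asc _ (not-asc (proj₂ p))))
                                        (if-same _ 0ℤ))))
      (sym (trans (cong (+ mult k (a ∷ l) *_) (off-head a l (ℕₚ.<⇒≢ a<k))) (ℤₚ.*-zeroʳ (+ mult k (a ∷ l))))))
  where
  not-asc : ∀ r → ¬ Asc (k ∷ a ∷ r)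
  not-asc r ((k≤a ∷ _) ∷ _) = ℕₚ.<⇒≱ a<k k≤a
... | tri≈ _ refl _ = ∑-splits-singleton-all a G (ℕₚ.≤-refl ∷ a≤l) (a≤l ∷ asc)
... | tri> _ _ k<a = trans (∑-splits-singleton-none k _ ((ℕₚ.<⇒≢ k<a ∘ sym) ∷ All.map (λ a≤c e → ℕₚ.<-irrefl (sym e) (ℕₚ.<-≤-trans k<a a≤c)) a≤l))
      (sym (trans (cong (+ mult k (a ∷ l) *_) (off-head a l (ℕₚ.<⇒≢ k<a ∘ sym))) (ℤₚ.*-zeroʳ (+ mult k (a ∷ l)))))

⟦⟧-isNil : ∀ N T → Admissible N T → (∀ x → ⟦ T ⟧ (λ ν → pν N ν x) ≡ 0ℤ) → ⟦ T ⟧ isNil ≡ 0ℤ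
⟦⟧-isNil N T adm vanishes =
  trans (sym (⟦⟧-cong-All T adm (λ ν adm-ν → pν-zero N (proj₁ (proj₂ adm-ν))))) (vanishes (λ _ → 0ℤ))

m∣n! : ∀ {m n} → 1 ≤ m → m ≤ n → m ∣ n !
m∣n! {suc m} _ m≤n = ∣-trans (m∣m*n (m !)) (m≤n⇒m!∣n! m≤n)

-- As a polynomial in the first variable y, ⟦ T ⟧ (p_ν (y ◂ x)) has vanishing
-- coefficients, and by the induction hypothesis the coefficient of y^(k+1) gives a relation
-- for every h. Removing a single part k+1 returns, times its multiplicity, each shape whose
-- smallest part is k+1, while every other removal of parts of total size k+1 involves a smaller
-- part; so induction on the smallest part disposes of every g. The factor W = (N+1)! makes all
-- multiplicities divide.
module IndependenceStep (N : ℕ) (IH : PowerSumsIndependent N) (T : Combination) (adm : Admissible (suc N) T)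
                        (vanishes : ∀ x → ⟦ T ⟧ (λ ν → pν (suc N) ν x) ≡ 0ℤ) where

  coefficient-vanishes : ∀ k h →
    ⟦ T ⟧ (λ ν → ∑[ p ∈ splits ν ] (if sum (proj₁ p) ≡ᵇ suc k then h (proj₂ p) else 0ℤ)) ≡ 0ℤ
  coefficient-vanishes k h = trans (sym (⟦dropParts⟧ (suc k) T h))
    (IH (dropParts (suc k) T) (dropParts-admissible N k T adm) dropped-vanishes h)
    where
    dropped-vanishes : ∀ x → ⟦ dropParts (suc k) T ⟧ (λ ν → pν N ν x) ≡ 0ℤ
    dropped-vanishes x = trans (sym (coeff-polyInFirst N T x (suc k)))
      (vanishing⇒coeff≡0 (polyInFirst N T x) (λ y → trans (evalPoly-polyInFirst N T x (+ suc y)) (vanishes _)) (suc k))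

  W : ℕ
  W = suc N !

  module HeadStep (k : ℕ) (below : ∀ g → ⟦ T ⟧ (headBelow (suc k) g) ≡ 0ℤ) (g : List ℕ → ℤ) where

    -- The divisor suc (m ∸ 1) equals the multiplicity m wherever it matters (m ≥ 1) and is never 0.
    scaled : List ℕ → ℤ
    scaled ν with allPairs? _≤?_ ν
    ... | yes _ = headIs (suc k) (λ μ → g μ * + (W / suc (mult (suc k) μ ∸ 1))) ν
    ... | no _ = 0ℤ

    scaled-off-head : ∀ b l → ¬ b ≡ suc k → scaled (b ∷ l) ≡ 0ℤ
    scaled-off-head b l b≢k with allPairs? _≤?_ (b ∷ l)
    ... | yes _ rewrite ≡ᵇ-false b≢k = refl
    ... | no _ = refl

    scaled-off-asc : ∀ l → ¬ Asc l → scaled l ≡ 0ℤ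
    scaled-off-asc l ¬asc with allPairs? _≤?_ l
    ... | yes asc = ⊥-elim (¬asc asc)
    ... | no _ = refl

    mult*scaled : ∀ ν → IsAscPartition≤ (suc N) ν → + mult (suc k) ν * scaled ν ≡ + W * headIs (suc k) g ν
    mult*scaled ν (asc , _ , _) with allPairs? _≤?_ ν
    ... | no ¬asc = ⊥-elim (¬asc asc)
    mult*scaled [] _ | yes _ = trans (ℤₚ.*-zeroˡ 0ℤ) (sym (ℤₚ.*-zeroʳ (+ W)))
    mult*scaled (a ∷ l) (_ , pos , ν≤) | yes _ with a ≟ suc k
    ... | no a≢k = trans (cong (+ mult (suc k) (a ∷ l) *_) (headIs-off {l = l} (λ μ → g μ * + (W / suc (mult (suc k) μ ∸ 1))) a≢k))
                     (trans (ℤₚ.*-zeroʳ (+ mult (suc k) (a ∷ l)))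
                            (sym (trans (cong (+ W *_) (headIs-off {l = l} g a≢k)) (ℤₚ.*-zeroʳ (+ W)))))
    ... | yes refl rewrite ≡ᵇ-refl a = begin
      + m * (g (a ∷ l) * + (W / suc (m ∸ 1)))  ≡⟨ reorder (+ m) (g (a ∷ l)) (+ (W / suc (m ∸ 1))) ⟩
      + m * + (W / suc (m ∸ 1)) * g (a ∷ l)    ≡⟨ cong (_* g (a ∷ l)) (trans (sym (ℤₚ.pos-* m _)) (cong +_ m*[W/m]≡W)) ⟩
      + W * g (a ∷ l)                          ∎
      where
      open ≡-Reasoning
      m = suc (mult a l)
      reorder : ∀ x y z → x * (y * z) ≡ x * z * y
      reorder = solve-∀
      m≤1+N : m ≤ suc N
      m≤1+N = ℕₚ.≤-trans (subst (_≤ length (a ∷ l)) (mult-head a l) (mult≤length a (a ∷ l))) (ℕₚ.≤-trans (length≤sum pos) ν≤)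
      m*[W/m]≡W : m ℕ.* (W / suc (m ∸ 1)) ≡ W
      m*[W/m]≡W = m*[n/m]≡n (m∣n! (s≤s z≤n) m≤1+N)

    nonSingleton : List ℕ → ℤ → ℤ
    nonSingleton s z = if sum s ≡ᵇ suc k then (if isSingleton (suc k) s then 0ℤ else z) else 0ℤ

    size-split : ∀ s z → (if sum s ≡ᵇ suc k then z else 0ℤ) ≡ (if isSingleton (suc k) s then z else 0ℤ) + nonSingleton s z
    size-split s z with isSingleton (suc k) s in single | sum s ≡ᵇ suc k in size
    ... | true | true = sym (ℤₚ.+-identityʳ z)
    ... | true | false with () ← trans (sym (isSingleton-sum (suc k) s single)) size
    ... | false | true = sym (ℤₚ.+-identityˡ z)
    ... | false | false = refl

    rest : List ℕ → ℤ
    rest ν = ∑[ p ∈ splits ν ] nonSingleton (proj₁ p) (scaled (suc k ∷ proj₂ p))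

    -- Removing parts of total size k+1 other than a single part k+1 needs a part below k+1.
    rest-headBelow : ∀ ν → IsAscPartition≤ (suc N) ν → headBelow (suc k) rest ν ≡ rest ν
    rest-headBelow [] _ = refl
    rest-headBelow (a ∷ l) ((a≤l ∷ _) , _ , _) with a <? suc k
    ... | yes a<k rewrite <ᵇ-true a<k = refl
    ... | no a≮k rewrite <ᵇ-false a≮k = sym (∑-zero-All (All.map no-small-parts (splits-All all-large)))
      where
      all-large : All (suc k ≤_) (a ∷ l)
      all-large = ℕₚ.≮⇒≥ a≮k ∷ All.map (ℕₚ.≤-trans (ℕₚ.≮⇒≥ a≮k)) a≤l
      no-small-parts : ∀ {p} → All (suc k ≤_) (proj₁ p) × All (suc k ≤_) (proj₂ p) →
        nonSingleton (proj₁ p) (scaled (suc k ∷ proj₂ p)) ≡ 0ℤ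
      no-small-parts {p} (large , _) with sum (proj₁ p) ≡ᵇ suc k in size
      ... | true rewrite sum-isSingleton k (proj₁ p) large size = refl
      ... | false = refl

    headIs-vanishes : ⟦ T ⟧ (headIs (suc k) g) ≡ 0ℤ
    headIs-vanishes = cancel (begin
      + W * ⟦ T ⟧ (headIs (suc k) g)  ≡⟨ ℤₚ.+-identityʳ _ ⟨
      + W * ⟦ T ⟧ (headIs (suc k) g) + 0ℤ
        ≡⟨ cong₂ _+_ singles (trans (sym (⟦⟧-cong-All T adm rest-headBelow)) (below rest)) ⟨
      ⟦ T ⟧ singletons + ⟦ T ⟧ rest     ≡⟨ ⟦⟧-+ T singletons rest ⟨
      ⟦ T ⟧ (λ ν → singletons ν + rest ν)
        ≡⟨ ∑-cong T (λ t → cong (proj₁ t *_) (trans (∑-cong (splits (proj₂ t)) (λ p → size-split (proj₁ p) _))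
             (∑-+ (splits (proj₂ t)) _ _))) ⟨
      ⟦ T ⟧ (λ ν → ∑[ p ∈ splits ν ] (if sum (proj₁ p) ≡ᵇ suc k then scaled (suc k ∷ proj₂ p) else 0ℤ))
        ≡⟨ coefficient-vanishes k (λ β → scaled (suc k ∷ β)) ⟩
      0ℤ ∎)
      where
      open ≡-Reasoning
      singletons : List ℕ → ℤ
      singletons ν = ∑[ p ∈ splits ν ] (if isSingleton (suc k) (proj₁ p) then scaled (suc k ∷ proj₂ p) else 0ℤ)
      singles : ⟦ T ⟧ singletons ≡ + W * ⟦ T ⟧ (headIs (suc k) g)
      singles = trans (⟦⟧-cong-All T adm (λ ν adm-ν →
        trans (∑-splits-singleton (suc k) scaled scaled-off-head scaled-off-asc (proj₁ adm-ν)) (mult*scaled ν adm-ν)))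
        (⟦⟧-*ˡ T (+ W) _)
      cancel : ∀ {X} → + W * X ≡ 0ℤ → X ≡ 0ℤ
      cancel {X} eq with ℤₚ.i*j≡0⇒i≡0∨j≡0 (+ W) eq
      ... | inj₂ X≡0 = X≡0
      ... | inj₁ W≡0 = ⊥-elim (ℕ.≢-nonZero⁻¹ W {{suc N ℕₚ.!≢0}} (ℤₚ.+-injective W≡0))

  headBelow-vanishes : ∀ k g → ⟦ T ⟧ (headBelow k g) ≡ 0ℤ
  headBelow-vanishes zero g = ∑-zero T (λ t → trans (cong (proj₁ t *_) (nothing-below (proj₂ t))) (ℤₚ.*-zeroʳ (proj₁ t)))
    where
    nothing-below : ∀ ν → headBelow 0 g ν ≡ 0ℤ
    nothing-below [] = refl
    nothing-below (a ∷ l) = refl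
  headBelow-vanishes (suc k) g = begin
    ⟦ T ⟧ (headBelow (suc k) g)                          ≡⟨ ∑-cong T (λ t → cong (proj₁ t *_) (headBelow-suc k g (proj₂ t))) ⟩
    ⟦ T ⟧ (λ ν → headBelow k g ν + headIs k g ν)        ≡⟨ ⟦⟧-+ T (headBelow k g) (headIs k g) ⟩
    ⟦ T ⟧ (headBelow k g) + ⟦ T ⟧ (headIs k g)          ≡⟨ cong₂ _+_ (headBelow-vanishes k g) (headIs-vanishes k) ⟩
    0ℤ ∎
    where
    open ≡-Reasoning
    headIs-vanishes : ∀ k → ⟦ T ⟧ (headIs k g) ≡ 0ℤ
    headIs-vanishes zero = ∑-zero-All (All.map (λ {t} adm-t → trans (cong (proj₁ t *_) (no-zero-part (proj₂ t) adm-t))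
                                                                 (ℤₚ.*-zeroʳ (proj₁ t))) adm)
      where
      no-zero-part : ∀ ν → IsAscPartition≤ (suc N) ν → headIs 0 g ν ≡ 0ℤ
      no-zero-part [] _ = refl
      no-zero-part (suc a ∷ l) _ = refl
      no-zero-part (zero ∷ l) (_ , (() ∷ _) , _)
    headIs-vanishes (suc k) = HeadStep.headIs-vanishes k (headBelow-vanishes (suc k)) g

  vanishes-everywhere : ∀ g → ⟦ T ⟧ g ≡ 0ℤ
  vanishes-everywhere g = begin
    ⟦ T ⟧ g                                              ≡⟨ ⟦⟧-cong-All T adm decompose ⟩
    ⟦ T ⟧ (λ ν → g [] * isNil ν + headBelow (suc (suc N)) g ν)
      ≡⟨ ⟦⟧-+ T _ _ ⟩
    ⟦ T ⟧ (λ ν → g [] * isNil ν) + ⟦ T ⟧ (headBelow (suc (suc N)) g)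
      ≡⟨ cong₂ _+_ (⟦⟧-*ˡ T (g []) isNil) (headBelow-vanishes (suc (suc N)) g) ⟩
    g [] * ⟦ T ⟧ isNil + 0ℤ                             ≡⟨ cong (λ z → g [] * z + 0ℤ) (⟦⟧-isNil (suc N) T adm vanishes) ⟩
    g [] * 0ℤ + 0ℤ                                      ≡⟨ trans (ℤₚ.+-identityʳ _) (ℤₚ.*-zeroʳ (g [])) ⟩
    0ℤ ∎
    where
    open ≡-Reasoning
    decompose : ∀ ν → IsAscPartition≤ (suc N) ν → g ν ≡ g [] * isNil ν + headBelow (suc (suc N)) g ν
    decompose [] _ = sym (trans (ℤₚ.+-identityʳ _) (ℤₚ.*-identityʳ (g [])))
    decompose (a ∷ l) (_ , _ , ν≤) rewrite <ᵇ-true (s≤s (ℕₚ.≤-trans (ℕₚ.m≤m+n a (sum l)) ν≤)) =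
      sym (trans (cong (_+ g (a ∷ l)) (ℤₚ.*-zeroʳ (g []))) (ℤₚ.+-identityˡ _))

powerSums-independent : ∀ N → PowerSumsIndependent N
powerSums-independent zero T adm vanishes g = begin
  ⟦ T ⟧ g                     ≡⟨ ⟦⟧-cong-All T adm only-empty ⟩
  ⟦ T ⟧ (λ ν → g [] * isNil ν) ≡⟨ ⟦⟧-*ˡ T (g []) isNil ⟩
  g [] * ⟦ T ⟧ isNil           ≡⟨ cong (g [] *_) (⟦⟧-isNil 0 T adm vanishes) ⟩
  g [] * 0ℤ                   ≡⟨ ℤₚ.*-zeroʳ (g []) ⟩
  0ℤ ∎
  where
  open ≡-Reasoning
  only-empty : ∀ ν → IsAscPartition≤ 0 ν → g ν ≡ g [] * isNil ν
  only-empty [] _ = sym (ℤₚ.*-identityʳ (g []))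
  only-empty (a ∷ l) (_ , (1≤a ∷ _) , ν≤0) = ⊥-elim (ℕₚ.<-irrefl refl (ℕₚ.≤-trans 1≤a (ℕₚ.≤-trans (ℕₚ.m≤m+n a (sum l)) ν≤0)))
powerSums-independent (suc N) = IndependenceStep.vanishes-everywhere N (powerSums-independent N)

-- The chromatic symmetric function of a spider

∑-upTo-suc : ∀ K (F : ℕ → ℤ) → ∑ (upTo (suc K)) F ≡ ∑ (upTo K) F + F K
∑-upTo-suc K F = trans (cong (λ l → ∑ l F) (sym (Listₚ.upTo-∷ʳ K)))
  (trans (∑-++ (upTo K) (K ∷ []) F) (cong (_+_ (∑ (upTo K) F)) (ℤₚ.+-identityʳ (F K))))

upTo-< : ∀ K → All (_< K) (upTo K)
upTo-< K = Allₚ.applyUpTo⁺₁ id K id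

∑-upTo-indicator : ∀ K c (F : ℕ → ℤ) → c < K → ∑[ d ∈ upTo K ] (if c ≡ᵇ d then F d else 0ℤ) ≡ F c
∑-upTo-indicator (suc K) c F c<1+K with ℕₚ.<-cmp c K
... | tri< c<K _ _ = trans (∑-upTo-suc K _) (trans (cong₂ _+_ (∑-upTo-indicator K c F c<K)
  (cong (λ b → if b then F K else 0ℤ) (≡ᵇ-false (ℕₚ.<⇒≢ c<K)))) (ℤₚ.+-identityʳ (F c)))
... | tri≈ _ refl _ = trans (∑-upTo-suc c _) (trans (cong₂ _+_
  (∑-zero-All (All.map (λ {d} d<c → cong (λ b → if b then F d else 0ℤ) (≡ᵇ-false (ℕₚ.<⇒≢ d<c ∘ sym))) (upTo-< c)))
  (cong (λ b → if b then F c else 0ℤ) (≡ᵇ-refl c))) (ℤₚ.+-identityˡ (F c)))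
... | tri> _ _ K<c = ⊥-elim (ℕₚ.<-irrefl refl (ℕₚ.<-≤-trans K<c (ℕₚ.≤-pred c<1+K)))

∑-upTo-except : ∀ K c (F : ℕ → ℤ) → c < K → ∑[ d ∈ upTo K ] (if c ≡ᵇ d then 0ℤ else F d) ≡ ∑ (upTo K) F - F c
∑-upTo-except K c F c<K = begin
  ∑ (upTo K) except                                   ≡⟨ cancel (∑ (upTo K) except) (F c) ⟩
  F c + ∑ (upTo K) except - F c                       ≡⟨ cong (λ z → z + ∑ (upTo K) except - F c) (∑-upTo-indicator K c F c<K) ⟨
  ∑ (upTo K) only + ∑ (upTo K) except - F c           ≡⟨ cong (_- F c) (trans (sym (∑-+ (upTo K) only except)) (∑-cong (upTo K) recombine)) ⟩
  ∑ (upTo K) F - F c                                  ∎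
  where
  open ≡-Reasoning
  only except : ℕ → ℤ
  only d = if c ≡ᵇ d then F d else 0ℤ
  except d = if c ≡ᵇ d then 0ℤ else F d
  cancel : ∀ a b → a ≡ b + a - b
  cancel = solve-∀
  recombine : ∀ d → only d + except d ≡ F d
  recombine d with c ≡ᵇ d
  ... | true = ℤₚ.+-identityʳ (F d)
  ... | false = ℤₚ.+-identityˡ (F d)

weight : (ℕ → ℤ) → List ℕ → ℤ
weight x κ = prodℤ (map x κ)

weight-++ : ∀ x κ ρ → weight x (κ ++ ρ) ≡ weight x κ * weight x ρ
weight-++ x κ ρ = trans (cong prodℤ (Listₚ.map-++ x κ ρ)) (prodℤ-++ (map x κ) (map x ρ))

module _ (K : ℕ) where

  ∑-colourings-suc : ∀ len (F : List ℕ → ℤ) →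
    ∑ (colourings K (suc len)) F ≡ ∑[ c ∈ upTo K ] ∑[ κ ∈ colourings K len ] F (c ∷ κ)
  ∑-colourings-suc len F = trans (∑-concatMap _ (upTo K) F) (∑-cong (upTo K) (λ c → ∑-map (c ∷_) (colourings K len) F))

  ∑-colourings-+ : ∀ a b (F : List ℕ → ℤ) →
    ∑ (colourings K (a ℕ.+ b)) F ≡ ∑[ κ ∈ colourings K a ] ∑[ ρ ∈ colourings K b ] F (κ ++ ρ)
  ∑-colourings-+ zero b F = sym (ℤₚ.+-identityʳ _)
  ∑-colourings-+ (suc a) b F = trans (∑-colourings-suc (a ℕ.+ b) F)
    (trans (∑-cong (upTo K) (λ c → ∑-colourings-+ a b (λ κ → F (c ∷ κ)))) (sym (∑-colourings-suc a _)))

  colourings-length : ∀ len → All (λ κ → length κ ≡ len) (colourings K len)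
  colourings-length zero = refl ∷ []
  colourings-length (suc len) = All-concatMap (upTo K)
    where
    All-concatMap : ∀ cs → All (λ κ → length κ ≡ suc len) (concatMap (λ c → map (c ∷_) (colourings K len)) cs)
    All-concatMap [] = []
    All-concatMap (c ∷ cs) = Allₚ.++⁺ (Allₚ.map⁺ (All.map (cong suc) (colourings-length len))) (All-concatMap cs)

properPath : ℕ → List ℕ → Bool
properPath c [] = true
properPath c (d ∷ κ) = not (c ≡ᵇ d) ∧ properPath d κ

at-++ʳ : ∀ pre L j → at (pre ++ L) (length pre ℕ.+ j) ≡ at L j
at-++ʳ [] L j = refl
at-++ʳ (a ∷ pre) L j = at-++ʳ pre L j

at-++ˡ : ∀ κ ρ {j} → j < length κ → at (κ ++ ρ) j ≡ at κ j
at-++ˡ (a ∷ κ) ρ {zero} _ = refl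
at-++ˡ (a ∷ κ) ρ {suc j} (s≤s j<) = at-++ˡ κ ρ j<

proper-++ : ∀ A B κ → proper (A ++ B) κ ≡ proper A κ ∧ proper B κ
proper-++ [] B κ = refl
proper-++ (e ∷ A) B κ = trans (cong (not (at κ (proj₁ e) ≡ᵇ at κ (proj₂ e)) ∧_) (proper-++ A B κ))
  (sym (Boolₚ.∧-assoc _ (proper A κ) (proper B κ)))

properPath-at : ∀ d κ (g : ℕ → ℕ) → (∀ j → j ≤ length κ → g j ≡ at (d ∷ κ) j) →
  foldr _∧_ true (applyUpTo (λ j → not (g j ≡ᵇ g (suc j))) (length κ)) ≡ properPath d κ
properPath-at d [] g h = refl
properPath-at d (e ∷ κ) g h rewrite h 0 z≤n | h 1 (s≤s z≤n) =
  cong (not (d ≡ᵇ e) ∧_) (properPath-at e κ (g ∘ suc) (λ j j≤ → h (suc j) (s≤s j≤)))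

proper-legEdges : ∀ s l pre κ ρ c → length pre ≡ s → length κ ≡ l →
  proper (legEdges s l) (c ∷ pre ++ κ ++ ρ) ≡ properPath c κ
proper-legEdges s zero pre [] ρ c _ _ = refl
proper-legEdges s (suc l) pre (d ∷ κ) ρ c refl len = cong₂ _∧_ first rest
  where
  colouring = c ∷ pre ++ (d ∷ κ) ++ ρ
  first : not (c ≡ᵇ at colouring (suc s)) ≡ not (c ≡ᵇ d)
  first = cong (λ z → not (c ≡ᵇ z))
    (trans (cong (at (pre ++ (d ∷ κ) ++ ρ)) (sym (ℕₚ.+-identityʳ s))) (at-++ʳ pre ((d ∷ κ) ++ ρ) 0))
  g : ℕ → ℕ
  g j = at colouring (s ℕ.+ suc j)
  g-at : ∀ j → j ≤ length κ → g j ≡ at (d ∷ κ) j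
  g-at j j≤ = trans (cong (at colouring) (ℕₚ.+-suc s j))
    (trans (at-++ʳ pre ((d ∷ κ) ++ ρ) j) (at-++ˡ (d ∷ κ) ρ (s≤s j≤)))
  rest : foldr _∧_ true (map (λ e → not (at colouring (proj₁ e) ≡ᵇ at colouring (proj₂ e)))
                             (map (λ j → (s ℕ.+ suc j , s ℕ.+ suc (suc j))) (upTo l))) ≡ properPath d κ
  rest = trans (cong (foldr _∧_ true) (trans (sym (Listₚ.map-∘ (upTo l))) (Listₚ.map-upTo _ l)))
    (trans (cong (λ m → foldr _∧_ true (applyUpTo (λ j → not (g j ≡ᵇ g (suc j))) m)) (sym (ℕₚ.suc-injective len)))
      (properPath-at d κ g g-at))

-- w · z^e · p_ν, where z stands for the colour weight x_c of the vertex a leg hangs from.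
record ZTerm : Set where
  constructor zterm
  field
    coef : ℤ
    zdeg : ℕ
    parts : List ℕ

open ZTerm

ZPoly : Set
ZPoly = List ZTerm

-- ∑_d x_d · x_d^e p_ν = p_(e+1) p_ν
absorb : ZTerm → ZTerm
absorb (zterm w e ν) = zterm w 0 (suc e ∷ ν)

negMulZ : ZTerm → ZTerm
negMulZ (zterm w e ν) = zterm (- w) (suc e) ν

legPoly : ℕ → ZPoly
legPoly zero = zterm 1ℤ 0 [] ∷ []
legPoly (suc l) = map absorb (legPoly l) ++ map negMulZ (legPoly l)

_⊗_ : ZPoly → ZPoly → ZPoly
P ⊗ R = concatMap (λ a → map (λ b → zterm (coef a * coef b) (zdeg a ℕ.+ zdeg b) (parts a ++ parts b)) R) P

legsPoly : List ℕ → ZPoly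
legsPoly [] = zterm 1ℤ 0 [] ∷ []
legsPoly (l ∷ ls) = legPoly l ⊗ legsPoly ls

spiderExpansion : List ℕ → Combination
spiderExpansion legs = map (λ t → (coef t , suc (zdeg t) ∷ parts t)) (legsPoly legs)

pν-++ : ∀ K ν μ x → pν K (ν ++ μ) x ≡ pν K ν x * pν K μ x
pν-++ K ν μ x = trans (cong prodℤ (Listₚ.map-++ (λ k → powerSum K k x) ν μ))
  (prodℤ-++ (map (λ k → powerSum K k x) ν) (map (λ k → powerSum K k x) μ))

ifand : ∀ b₁ b₂ (u v : ℤ) → (if b₁ ∧ b₂ then u * v else 0ℤ) ≡ (if b₁ then u else 0ℤ) * (if b₂ then v else 0ℤ)
ifand true true u v = refl
ifand true false u v = sym (ℤₚ.*-zeroʳ u)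
ifand false b₂ u v = sym (ℤₚ.*-zeroˡ (if b₂ then v else 0ℤ))

module Colourings (K : ℕ) (x : ℕ → ℤ) where

  legSum : ℕ → ℕ → ℤ
  legSum l c = ∑[ κ ∈ colourings K l ] (if properPath c κ then weight x κ else 0ℤ)

  legsProduct : List ℕ → ℕ → ℤ
  legsProduct [] c = 1ℤ
  legsProduct (l ∷ ls) c = legSum l c * legsProduct ls c

  -- The legs of a spider are coloured independently once the centre colour c is fixed.
  ∑-proper-legs : ∀ ls s pre c → length pre ≡ s →
    ∑[ ρ ∈ colourings K (sum ls) ] (if proper (spiderEdgesFrom s ls) (c ∷ pre ++ ρ) then weight x ρ else 0ℤ)
      ≡ legsProduct ls c
  ∑-proper-legs [] s pre c _ = refl
  ∑-proper-legs (l ∷ ls) s pre c len = trans (∑-colourings-+ K l (sum ls) _)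
    (trans (∑-cong-All (All.map (λ {κ} → first-leg κ) (colourings-length K l))) (∑-*ʳ (colourings K l) (legsProduct ls c) _))
    where
    first-leg : ∀ κ → length κ ≡ l →
      ∑[ ρ ∈ colourings K (sum ls) ] (if proper (spiderEdgesFrom s (l ∷ ls)) (c ∷ pre ++ κ ++ ρ) then weight x (κ ++ ρ) else 0ℤ)
        ≡ (if properPath c κ then weight x κ else 0ℤ) * legsProduct ls c
    first-leg κ lenκ = trans (∑-cong (colourings K (sum ls)) split)
      (trans (∑-*ˡ (colourings K (sum ls)) (if properPath c κ then weight x κ else 0ℤ) _)
        (cong ((if properPath c κ then weight x κ else 0ℤ) *_)
          (∑-proper-legs ls (s ℕ.+ l) (pre ++ κ) c (trans (Listₚ.length-++ pre) (cong₂ ℕ._+_ len lenκ)))))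
      where
      split : ∀ ρ → (if proper (spiderEdgesFrom s (l ∷ ls)) (c ∷ pre ++ κ ++ ρ) then weight x (κ ++ ρ) else 0ℤ)
        ≡ (if properPath c κ then weight x κ else 0ℤ)
          * (if proper (spiderEdgesFrom (s ℕ.+ l) ls) (c ∷ (pre ++ κ) ++ ρ) then weight x ρ else 0ℤ)
      split ρ = trans (cong₂ (λ b w → if b then w else 0ℤ)
        (trans (proper-++ (legEdges s l) (spiderEdgesFrom (s ℕ.+ l) ls) (c ∷ pre ++ κ ++ ρ))
          (cong₂ _∧_ (proper-legEdges s l pre κ ρ c len lenκ)
                     (cong (λ z → proper (spiderEdgesFrom (s ℕ.+ l) ls) (c ∷ z)) (sym (Listₚ.++-assoc pre κ ρ)))))
        (weight-++ x κ ρ)) (ifand (properPath c κ) (proper (spiderEdgesFrom (s ℕ.+ l) ls) (c ∷ (pre ++ κ) ++ ρ)) (weight x κ) (weight x ρ))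

  legSum-suc : ∀ l c → c < K → legSum (suc l) c ≡ ∑[ d ∈ upTo K ] (x d * legSum l d) - x c * legSum l c
  legSum-suc l c c<K = trans (∑-colourings-suc K l _)
    (trans (∑-cong (upTo K) first-vertex) (∑-upTo-except K c (λ d → x d * legSum l d) c<K))
    where
    first-vertex : ∀ d → ∑[ κ ∈ colourings K l ] (if properPath c (d ∷ κ) then weight x (d ∷ κ) else 0ℤ)
                         ≡ (if c ≡ᵇ d then 0ℤ else x d * legSum l d)
    first-vertex d with c ≡ᵇ d
    ... | true = ∑-zero (colourings K l) (λ _ → refl)
    ... | false = trans (∑-cong (colourings K l) (λ κ → sym (if-*ˡ (properPath d κ) (x d) (weight x κ))))
                        (∑-*ˡ (colourings K l) (x d) _)

  evalZ : ZPoly → ℤ → ℤ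
  evalZ Q z = ∑[ t ∈ Q ] (coef t * z ^ zdeg t * pν K (parts t) x)

  evalZ-absorb : ∀ Q z → ∑[ d ∈ upTo K ] (x d * evalZ Q (x d)) ≡ evalZ (map absorb Q) z
  evalZ-absorb Q z = trans (∑-cong (upTo K) (λ d → sym (∑-*ˡ Q (x d) _))) (trans (∑-swap (upTo K) Q _)
    (trans (∑-cong Q absorbed) (sym (∑-map absorb Q _))))
    where
    absorbed : ∀ t → ∑[ d ∈ upTo K ] (x d * (coef t * x d ^ zdeg t * pν K (parts t) x))
                     ≡ coef (absorb t) * z ^ zdeg (absorb t) * pν K (parts (absorb t)) x
    absorbed (zterm w e ν) = begin
      ∑[ d ∈ upTo K ] (x d * (w * x d ^ e * pν K ν x))       ≡⟨ ∑-cong (upTo K) (λ d → reorder (x d) w (x d ^ e) (pν K ν x)) ⟩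
      ∑[ d ∈ upTo K ] (x d * x d ^ e * (w * pν K ν x))       ≡⟨ ∑-*ʳ (upTo K) (w * pν K ν x) _ ⟩
      ∑[ d ∈ upTo K ] (x d ^ suc e) * (w * pν K ν x)         ≡⟨ cong (_* (w * pν K ν x)) (sumℤ-map (upTo K) (λ i → x i ^ suc e)) ⟨
      powerSum K (suc e) x * (w * pν K ν x)                  ≡⟨ collect (powerSum K (suc e) x) w (pν K ν x) ⟩
      w * 1ℤ * (powerSum K (suc e) x * pν K ν x)             ∎
      where
      open ≡-Reasoning
      reorder : ∀ a b c d → a * (b * c * d) ≡ a * c * (b * d)
      reorder = solve-∀
      collect : ∀ p w q → p * (w * q) ≡ w * 1ℤ * (p * q)
      collect = solve-∀

  evalZ-negMulZ : ∀ Q z → - (z * evalZ Q z) ≡ evalZ (map negMulZ Q) z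
  evalZ-negMulZ Q z = trans (cong -_ (sym (∑-*ˡ Q z _)))
    (trans (sym (∑-neg Q _)) (trans (∑-cong Q shifted) (sym (∑-map negMulZ Q _))))
    where
    shifted : ∀ t → - (z * (coef t * z ^ zdeg t * pν K (parts t) x))
                    ≡ coef (negMulZ t) * z ^ zdeg (negMulZ t) * pν K (parts (negMulZ t)) x
    shifted (zterm w e ν) = reorder z w (z ^ e) (pν K ν x)
      where
      reorder : ∀ z w q p → - (z * (w * q * p)) ≡ - w * (z * q) * p
      reorder = solve-∀

  legSum-legPoly : ∀ l c → c < K → legSum l c ≡ evalZ (legPoly l) (x c)
  legSum-legPoly zero c _ = refl
  legSum-legPoly (suc l) c c<K = begin
    legSum (suc l) c
      ≡⟨ legSum-suc l c c<K ⟩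
    ∑[ d ∈ upTo K ] (x d * legSum l d) - x c * legSum l c
      ≡⟨ cong₂ _-_ (∑-cong-All (All.map (λ {d} d<K → cong (x d *_) (legSum-legPoly l d d<K)) (upTo-< K)))
                   (cong (x c *_) (legSum-legPoly l c c<K)) ⟩
    ∑[ d ∈ upTo K ] (x d * evalZ (legPoly l) (x d)) - x c * evalZ (legPoly l) (x c)
      ≡⟨ cong₂ _+_ (evalZ-absorb (legPoly l) (x c)) (evalZ-negMulZ (legPoly l) (x c)) ⟩
    evalZ (map absorb (legPoly l)) (x c) + evalZ (map negMulZ (legPoly l)) (x c)
      ≡⟨ ∑-++ (map absorb (legPoly l)) (map negMulZ (legPoly l)) _ ⟨
    evalZ (legPoly (suc l)) (x c) ∎
    where open ≡-Reasoning

  evalZ-⊗ : ∀ P R z → evalZ (P ⊗ R) z ≡ evalZ P z * evalZ R z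
  evalZ-⊗ P R z = trans (∑-concatMap _ P _)
    (trans (∑-cong P (λ a → trans (∑-map _ R _) (trans (∑-cong R (product a)) (∑-*ˡ R (ev a) ev)))) (∑-*ʳ P (evalZ R z) ev))
    where
    ev : ZTerm → ℤ
    ev t = coef t * z ^ zdeg t * pν K (parts t) x
    product : ∀ a b → ev (zterm (coef a * coef b) (zdeg a ℕ.+ zdeg b) (parts a ++ parts b)) ≡ ev a * ev b
    product (zterm w e ν) (zterm w′ e′ ν′) =
      trans (cong₂ (λ p q → w * w′ * p * q) (ℤₚ.^-distribˡ-+-* z e e′) (pν-++ K ν ν′ x))
        (reorder w w′ (z ^ e) (z ^ e′) (pν K ν x) (pν K ν′ x))
      where
      reorder : ∀ a b c d e f → a * b * (c * d) * (e * f) ≡ a * c * e * (b * d * f)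
      reorder = solve-∀

  legsProduct-legsPoly : ∀ ls c → c < K → legsProduct ls c ≡ evalZ (legsPoly ls) (x c)
  legsProduct-legsPoly [] c _ = refl
  legsProduct-legsPoly (l ∷ ls) c c<K = trans (cong₂ _*_ (legSum-legPoly l c c<K) (legsProduct-legsPoly ls c c<K))
    (sym (evalZ-⊗ (legPoly l) (legsPoly ls) (x c)))

chromX-spider : ∀ legs x → chromX (order legs) (spiderEdges legs) x ≡ ⟦ spiderExpansion legs ⟧ (λ ν → pν (order legs) ν x)
chromX-spider legs x = begin
  chromX n E x
    ≡⟨ sumℤ-map (colourings n n) _ ⟩
  ∑ (colourings n (suc (sum legs))) properWeight
    ≡⟨ ∑-colourings-suc n (sum legs) properWeight ⟩
  ∑[ c ∈ upTo n ] ∑[ ρ ∈ colourings n (sum legs) ] properWeight (c ∷ ρ)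
    ≡⟨ ∑-cong (upTo n) centre ⟩
  ∑[ c ∈ upTo n ] (x c * legsProduct legs c)
    ≡⟨ ∑-cong-All (All.map (λ {c} c<n → cong (x c *_) (legsProduct-legsPoly legs c c<n)) (upTo-< n)) ⟩
  ∑[ d ∈ upTo n ] (x d * evalZ (legsPoly legs) (x d))
    ≡⟨ evalZ-absorb (legsPoly legs) 0ℤ ⟩
  evalZ (map absorb (legsPoly legs)) 0ℤ
    ≡⟨ ∑-map absorb (legsPoly legs) _ ⟩
  ∑[ t ∈ legsPoly legs ] (coef t * 1ℤ * pν n (suc (zdeg t) ∷ parts t) x)
    ≡⟨ ∑-cong (legsPoly legs) (λ t → cong (_* pν n (suc (zdeg t) ∷ parts t) x) (ℤₚ.*-identityʳ (coef t))) ⟩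
  ∑[ t ∈ legsPoly legs ] (coef t * pν n (suc (zdeg t) ∷ parts t) x)
    ≡⟨ ∑-map _ (legsPoly legs) _ ⟨
  ⟦ spiderExpansion legs ⟧ (λ ν → pν n ν x) ∎
  where
  open ≡-Reasoning
  n = order legs
  E = spiderEdges legs
  open Colourings n x
  properWeight : List ℕ → ℤ
  properWeight κ = if proper E κ then prodℤ (map x κ) else 0ℤ
  centre : ∀ c → ∑[ ρ ∈ colourings n (sum legs) ] properWeight (c ∷ ρ) ≡ x c * legsProduct legs c
  centre c = trans (∑-cong (colourings n (sum legs)) (λ ρ → sym (if-*ˡ (proper E (c ∷ ρ)) (x c) (weight x ρ))))
    (trans (∑-*ˡ (colourings n (sum legs)) (x c) _) (cong (x c *_) (∑-proper-legs legs 0 [] c refl)))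

-- Coefficients of one-part and empty shapes

Homogeneous : ℕ → ZPoly → Set
Homogeneous D Q = All (λ t → zdeg t ℕ.+ sum (parts t) ≡ D) Q

PositiveParts : ZPoly → Set
PositiveParts Q = All (λ t → All (1 ≤_) (parts t)) Q

legPoly-homogeneous : ∀ l → Homogeneous l (legPoly l)
legPoly-homogeneous zero = refl ∷ []
legPoly-homogeneous (suc l) = Allₚ.++⁺ (Allₚ.map⁺ (All.map (λ {t} → absorbed t) (legPoly-homogeneous l)))
                                        (Allₚ.map⁺ (All.map (λ {t} → shifted t) (legPoly-homogeneous l)))
  where
  absorbed shifted : ∀ t → zdeg t ℕ.+ sum (parts t) ≡ l → _
  absorbed (zterm w e ν) = cong suc
  shifted (zterm w e ν) = cong suc

legPoly-positive : ∀ l → PositiveParts (legPoly l)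
legPoly-positive zero = [] ∷ []
legPoly-positive (suc l) = Allₚ.++⁺ (Allₚ.map⁺ (All.map (λ {t} → absorbed t) (legPoly-positive l)))
                                     (Allₚ.map⁺ (All.map (λ {t} → shifted t) (legPoly-positive l)))
  where
  absorbed shifted : ∀ t → All (1 ≤_) (parts t) → _
  absorbed (zterm w e ν) = s≤s z≤n ∷_
  shifted (zterm w e ν) = id

⊗-All : ∀ {A B C : ZTerm → Set} (P R : ZPoly) →
  (∀ {a b} → A a → B b → C (zterm (coef a * coef b) (zdeg a ℕ.+ zdeg b) (parts a ++ parts b))) →
  All A P → All B R → All C (P ⊗ R)
⊗-All [] R combine [] _ = []
⊗-All (a ∷ P) R combine (pa ∷ pP) pR = Allₚ.++⁺ (Allₚ.map⁺ (All.map (combine pa) pR)) (⊗-All P R combine pP pR)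

⊗-homogeneous : ∀ {D₁ D₂} P R → Homogeneous D₁ P → Homogeneous D₂ R → Homogeneous (D₁ ℕ.+ D₂) (P ⊗ R)
⊗-homogeneous {D₁} {D₂} P R = ⊗-All P R (λ {a} {b} → combine a b)
  where
  combine : ∀ a b → zdeg a ℕ.+ sum (parts a) ≡ D₁ → zdeg b ℕ.+ sum (parts b) ≡ D₂ →
    zdeg a ℕ.+ zdeg b ℕ.+ sum (parts a ++ parts b) ≡ D₁ ℕ.+ D₂
  combine (zterm w e ν) (zterm w′ e′ ν′) refl refl rewrite sum-++ ν ν′ = interchange e e′ (sum ν) (sum ν′)
    where
    interchange : ∀ a b c d → a ℕ.+ b ℕ.+ (c ℕ.+ d) ≡ a ℕ.+ c ℕ.+ (b ℕ.+ d)
    interchange = solve-∀ℕ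

legsPoly-homogeneous : ∀ ls → Homogeneous (sum ls) (legsPoly ls)
legsPoly-homogeneous [] = refl ∷ []
legsPoly-homogeneous (l ∷ ls) = ⊗-homogeneous (legPoly l) (legsPoly ls) (legPoly-homogeneous l) (legsPoly-homogeneous ls)

legsPoly-positive : ∀ ls → PositiveParts (legsPoly ls)
legsPoly-positive [] = [] ∷ []
legsPoly-positive (l ∷ ls) = ⊗-All (legPoly l) (legsPoly ls) Allₚ.++⁺ (legPoly-positive l) (legsPoly-positive ls)

⟪_⟫ : ZPoly → (List ℕ → ℤ) → ℤ
⟪ Q ⟫ φ = ∑[ t ∈ Q ] (coef t * φ (parts t))

⟪⊗⟫-multiplicative : ∀ φ → (∀ ν μ → φ (ν ++ μ) ≡ φ ν * φ μ) → ∀ P R → ⟪ P ⊗ R ⟫ φ ≡ ⟪ P ⟫ φ * ⟪ R ⟫ φ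
⟪⊗⟫-multiplicative φ φ-++ P R = trans (∑-concatMap _ P _)
  (trans (∑-cong P (λ a → trans (∑-map _ R _) (trans (∑-cong R (product a)) (∑-*ˡ R (term a) term)))) (∑-*ʳ P (⟪ R ⟫ φ) term))
  where
  term : ZTerm → ℤ
  term t = coef t * φ (parts t)
  product : ∀ a b → coef a * coef b * φ (parts a ++ parts b) ≡ term a * term b
  product (zterm w e ν) (zterm w′ e′ ν′) = trans (cong (w * w′ *_) (φ-++ ν ν′)) (reorder w w′ (φ ν) (φ ν′))
    where
    reorder : ∀ a b c d → a * b * (c * d) ≡ a * c * (b * d)
    reorder = solve-∀

⟪⊗⟫-derivation : ∀ δ φ → (∀ ν μ → δ (ν ++ μ) ≡ δ ν * φ μ + φ ν * δ μ) → ∀ P R →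
  ⟪ P ⊗ R ⟫ δ ≡ ⟪ P ⟫ δ * ⟪ R ⟫ φ + ⟪ P ⟫ φ * ⟪ R ⟫ δ
⟪⊗⟫-derivation δ φ δ-++ P R = begin
  ⟪ P ⊗ R ⟫ δ
    ≡⟨ ∑-concatMap _ P _ ⟩
  ∑[ a ∈ P ] ∑ (map _ R) (λ t → coef t * δ (parts t))
    ≡⟨ ∑-cong P (λ a → trans (∑-map _ R _) (trans (∑-cong R (leibniz a)) (∑-+ R _ _))) ⟩
  ∑[ a ∈ P ] (∑[ b ∈ R ] (d a * f b) + ∑[ b ∈ R ] (f a * d b))
    ≡⟨ ∑-+ P _ _ ⟩
  ∑[ a ∈ P ] ∑[ b ∈ R ] (d a * f b) + ∑[ a ∈ P ] ∑[ b ∈ R ] (f a * d b)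
    ≡⟨ cong₂ _+_ (trans (∑-cong P (λ a → ∑-*ˡ R (d a) f)) (∑-*ʳ P (⟪ R ⟫ φ) d))
                 (trans (∑-cong P (λ a → ∑-*ˡ R (f a) d)) (∑-*ʳ P (⟪ R ⟫ δ) f)) ⟩
  ⟪ P ⟫ δ * ⟪ R ⟫ φ + ⟪ P ⟫ φ * ⟪ R ⟫ δ ∎
  where
  open ≡-Reasoning
  d f : ZTerm → ℤ
  d t = coef t * δ (parts t)
  f t = coef t * φ (parts t)
  leibniz : ∀ a b → coef a * coef b * δ (parts a ++ parts b) ≡ d a * f b + f a * d b
  leibniz (zterm w e ν) (zterm w′ e′ ν′) = trans (cong (w * w′ *_) (δ-++ ν ν′)) (reorder w w′ (δ ν) (φ ν′) (φ ν) (δ ν′))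
    where
    reorder : ∀ a b c d e f → a * b * (c * d + e * f) ≡ a * c * (b * d) + a * e * (b * f)
    reorder = solve-∀

isSingle : ℕ → List ℕ → ℤ
isSingle j (a ∷ []) = if a ≡ᵇ j then 1ℤ else 0ℤ
isSingle j _ = 0ℤ

isNil-++ : ∀ ν μ → isNil (ν ++ μ) ≡ isNil ν * isNil μ
isNil-++ [] μ = sym (ℤₚ.*-identityˡ (isNil μ))
isNil-++ (a ∷ ν) μ = refl

isSingle-++ : ∀ j ν μ → isSingle j (ν ++ μ) ≡ isSingle j ν * isNil μ + isNil ν * isSingle j μ
isSingle-++ j [] μ = sym (trans (cong (_+ 1ℤ * isSingle j μ) (ℤₚ.*-zeroˡ (isNil μ))) (trans (ℤₚ.+-identityˡ _) (ℤₚ.*-identityˡ _)))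
isSingle-++ j (a ∷ []) [] = sym (trans (ℤₚ.+-identityʳ _) (ℤₚ.*-identityʳ (isSingle j (a ∷ []))))
isSingle-++ j (a ∷ []) (b ∷ μ) = sym (trans (ℤₚ.+-identityʳ _) (ℤₚ.*-zeroʳ (isSingle j (a ∷ []))))
isSingle-++ j (a ∷ b ∷ ν) μ = refl

sgn : ℕ → ℤ
sgn zero = 1ℤ
sgn (suc l) = - sgn l

sgnAll : List ℕ → ℤ
sgnAll [] = 1ℤ
sgnAll (l ∷ ls) = sgn l * sgnAll ls

atLeast : ℕ → ℕ → ℕ
atLeast j l = if j ≤ᵇ l then 1 else 0

countAtLeast : ℕ → List ℕ → ℕ
countAtLeast j [] = 0
countAtLeast j (l ∷ ls) = atLeast j l ℕ.+ countAtLeast j ls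

atLeast-suc : ∀ j l → atLeast j l ≡ atLeast (suc j) (suc l)
atLeast-suc zero l = refl
atLeast-suc (suc j) l = refl

atLeast-split : ∀ j l → atLeast j l ≡ (if l ≡ᵇ j then 1 else 0) ℕ.+ atLeast (suc j) l
atLeast-split j l with ℕₚ.<-cmp j l
... | tri< j<l _ _ rewrite ≡ᵇ-false (ℕₚ.<⇒≢ j<l ∘ sym) | ≤ᵇ-true j<l | ≤ᵇ-true (ℕₚ.<⇒≤ j<l) = refl
... | tri≈ _ refl _ rewrite ≡ᵇ-refl j | ≤ᵇ-true (ℕₚ.≤-refl {j}) | ≤ᵇ-false (ℕₚ.<-irrefl {j} refl) = refl
... | tri> _ _ l<j rewrite ≡ᵇ-false (ℕₚ.<⇒≢ l<j) | ≤ᵇ-false (ℕₚ.<⇒≱ (ℕₚ.m<n⇒m<1+n l<j)) | ≤ᵇ-false (ℕₚ.<⇒≱ l<j) = refl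

⟪absorb⟫-isNil : ∀ Q → ⟪ map absorb Q ⟫ isNil ≡ 0ℤ
⟪absorb⟫-isNil Q = trans (∑-map absorb Q _) (∑-zero Q (λ t → ℤₚ.*-zeroʳ (coef t)))

⟪negMulZ⟫ : ∀ φ Q → ⟪ map negMulZ Q ⟫ φ ≡ - ⟪ Q ⟫ φ
⟪negMulZ⟫ φ Q = trans (∑-map negMulZ Q _) (trans (∑-cong Q (λ t → sym (ℤₚ.neg-distribˡ-* (coef t) (φ (parts t))))) (∑-neg Q _))

⟪absorb⟫-isSingle : ∀ j l Q → Homogeneous l Q → ⟪ map absorb Q ⟫ (isSingle j) ≡ ⟪ Q ⟫ isNil * (if suc l ≡ᵇ j then 1ℤ else 0ℤ)
⟪absorb⟫-isSingle j l Q hom = trans (∑-map absorb Q _) (trans (∑-cong-All (All.map (λ {t} → absorbed t) hom)) (∑-*ʳ Q _ _))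
  where
  absorbed : ∀ t → zdeg t ℕ.+ sum (parts t) ≡ l →
    coef (absorb t) * isSingle j (parts (absorb t)) ≡ coef t * isNil (parts t) * (if suc l ≡ᵇ j then 1ℤ else 0ℤ)
  absorbed (zterm w e []) refl = trans (cong (λ m → w * (if suc m ≡ᵇ j then 1ℤ else 0ℤ)) (sym (ℕₚ.+-identityʳ e)))
    (sym (cong (_* (if suc (e ℕ.+ 0) ≡ᵇ j then 1ℤ else 0ℤ)) (ℤₚ.*-identityʳ w)))
  absorbed (zterm w e (a ∷ ν)) _ = trans (ℤₚ.*-zeroʳ w)
    (sym (trans (cong (_* (if suc l ≡ᵇ j then 1ℤ else 0ℤ)) (ℤₚ.*-zeroʳ w)) (ℤₚ.*-zeroˡ (if suc l ≡ᵇ j then 1ℤ else 0ℤ))))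

⟪legPoly⟫-isNil : ∀ l → ⟪ legPoly l ⟫ isNil ≡ sgn l
⟪legPoly⟫-isNil zero = refl
⟪legPoly⟫-isNil (suc l) = trans (∑-++ (map absorb (legPoly l)) (map negMulZ (legPoly l)) _)
  (trans (cong₂ _+_ (⟪absorb⟫-isNil (legPoly l)) (⟪negMulZ⟫ isNil (legPoly l)))
    (trans (ℤₚ.+-identityˡ _) (cong -_ (⟪legPoly⟫-isNil l))))

⟪legPoly⟫-isSingle : ∀ j l → ⟪ legPoly l ⟫ (isSingle (suc j)) ≡ - sgn l * + atLeast (suc j) l
⟪legPoly⟫-isSingle j zero = refl
⟪legPoly⟫-isSingle j (suc l) = begin
  ⟪ map absorb (legPoly l) ++ map negMulZ (legPoly l) ⟫ (isSingle (suc j))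
    ≡⟨ ∑-++ (map absorb (legPoly l)) (map negMulZ (legPoly l)) _ ⟩
  ⟪ map absorb (legPoly l) ⟫ (isSingle (suc j)) + ⟪ map negMulZ (legPoly l) ⟫ (isSingle (suc j))
    ≡⟨ cong₂ _+_ (⟪absorb⟫-isSingle (suc j) l (legPoly l) (legPoly-homogeneous l)) (⟪negMulZ⟫ (isSingle (suc j)) (legPoly l)) ⟩
  ⟪ legPoly l ⟫ isNil * (if l ≡ᵇ j then 1ℤ else 0ℤ) + - ⟪ legPoly l ⟫ (isSingle (suc j))
    ≡⟨ cong₂ (λ a b → a * (if l ≡ᵇ j then 1ℤ else 0ℤ) + - b) (⟪legPoly⟫-isNil l) (⟪legPoly⟫-isSingle j l) ⟩
  sgn l * (if l ≡ᵇ j then 1ℤ else 0ℤ) + - (- sgn l * + atLeast (suc j) l)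
    ≡⟨ cong (λ q → sgn l * q + - (- sgn l * + atLeast (suc j) l)) (if-pos (l ≡ᵇ j)) ⟩
  sgn l * + (if l ≡ᵇ j then 1 else 0) + - (- sgn l * + atLeast (suc j) l)
    ≡⟨ factor (sgn l) (+ (if l ≡ᵇ j then 1 else 0)) (+ atLeast (suc j) l) ⟩
  sgn l * (+ (if l ≡ᵇ j then 1 else 0) + + atLeast (suc j) l)
    ≡⟨ cong (sgn l *_) (trans (sym (ℤₚ.pos-+ (if l ≡ᵇ j then 1 else 0) (atLeast (suc j) l))) (cong +_ (sym (atLeast-split j l)))) ⟩
  sgn l * + atLeast j l
    ≡⟨ cong₂ (λ q r → q * + r) (sym (ℤₚ.neg-involutive (sgn l))) (atLeast-suc j l) ⟩
  - sgn (suc l) * + atLeast (suc j) (suc l) ∎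
  where
  open ≡-Reasoning
  if-pos : ∀ (b : Bool) → (if b then 1ℤ else 0ℤ) ≡ + (if b then 1 else 0)
  if-pos true = refl
  if-pos false = refl
  factor : ∀ s a b → s * a + - (- s * b) ≡ s * (a + b)
  factor = solve-∀

⟪legsPoly⟫-isNil : ∀ ls → ⟪ legsPoly ls ⟫ isNil ≡ sgnAll ls
⟪legsPoly⟫-isNil [] = refl
⟪legsPoly⟫-isNil (l ∷ ls) = trans (⟪⊗⟫-multiplicative isNil isNil-++ (legPoly l) (legsPoly ls))
  (cong₂ _*_ (⟪legPoly⟫-isNil l) (⟪legsPoly⟫-isNil ls))

⟪legsPoly⟫-isSingle : ∀ j ls → ⟪ legsPoly ls ⟫ (isSingle (suc j)) ≡ - sgnAll ls * + countAtLeast (suc j) ls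
⟪legsPoly⟫-isSingle j [] = refl
⟪legsPoly⟫-isSingle j (l ∷ ls) = begin
  ⟪ legPoly l ⊗ legsPoly ls ⟫ (isSingle (suc j))
    ≡⟨ ⟪⊗⟫-derivation (isSingle (suc j)) isNil (isSingle-++ (suc j)) (legPoly l) (legsPoly ls) ⟩
  ⟪ legPoly l ⟫ (isSingle (suc j)) * ⟪ legsPoly ls ⟫ isNil + ⟪ legPoly l ⟫ isNil * ⟪ legsPoly ls ⟫ (isSingle (suc j))
    ≡⟨ cong₂ _+_ (cong₂ _*_ (⟪legPoly⟫-isSingle j l) (⟪legsPoly⟫-isNil ls)) (cong₂ _*_ (⟪legPoly⟫-isNil l) (⟪legsPoly⟫-isSingle j ls)) ⟩
  - sgn l * + atLeast (suc j) l * sgnAll ls + sgn l * (- sgnAll ls * + countAtLeast (suc j) ls)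
    ≡⟨ factor (sgn l) (sgnAll ls) (+ atLeast (suc j) l) (+ countAtLeast (suc j) ls) ⟩
  - (sgn l * sgnAll ls) * (+ atLeast (suc j) l + + countAtLeast (suc j) ls)
    ≡⟨ cong (- (sgn l * sgnAll ls) *_) (sym (ℤₚ.pos-+ (atLeast (suc j) l) (countAtLeast (suc j) ls))) ⟩
  - sgnAll (l ∷ ls) * + countAtLeast (suc j) (l ∷ ls) ∎
  where
  open ≡-Reasoning
  factor : ∀ s t a b → - s * a * t + s * (- t * b) ≡ - (s * t) * (a + b)
  factor = solve-∀

∣sgnAll∣ : ∀ ls → ∣ sgnAll ls ∣ ≡ 1
∣sgnAll∣ [] = refl
∣sgnAll∣ (l ∷ ls) = trans (ℤₚ.abs-* (sgn l) (sgnAll ls)) (cong₂ ℕ._*_ (∣sgn∣ l) (∣sgnAll∣ ls))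
  where
  ∣sgn∣ : ∀ l → ∣ sgn l ∣ ≡ 1
  ∣sgn∣ zero = refl
  ∣sgn∣ (suc l) = trans (ℤₚ.∣-i∣≡∣i∣ (sgn l)) (∣sgn∣ l)

Desc : List ℕ → Set
Desc = AllPairs _≥_

sort-desc : ∀ μ → Desc (sort μ)
sort-desc μ = Linked⇒AllPairs (λ k≤j j≤i → ℕₚ.≤-trans j≤i k≤j) (sort-↗ μ)

prodℤ-↭ : ∀ {xs ys} → xs ↭ ys → prodℤ xs ≡ prodℤ ys
prodℤ-↭ p = foldr-commMonoid ℤ-*-1.setoid ℤ-*-1.isCommutativeMonoid (↭⇒↭ₛ p)
  where module ℤ-*-1 = CommutativeMonoid ℤₚ.*-1-commutativeMonoid

pν-↭ : ∀ K x {μ ν} → μ ↭ ν → pν K μ x ≡ pν K ν x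
pν-↭ K x p = prodℤ-↭ (Permₚ.map⁺ (λ k → powerSum K k x) p)

Asc-∷ʳ : ∀ {l a} → Asc l → All (_≤ a) l → Asc (l ∷ʳ a)
Asc-∷ʳ [] [] = [] ∷ []
Asc-∷ʳ (b≤l ∷ asc) (b≤a ∷ l≤a) = Allₚ.∷ʳ⁺ b≤l b≤a ∷ Asc-∷ʳ asc l≤a

Desc-reverse : ∀ {l} → Desc l → Asc (reverse l)
Desc-reverse [] = []
Desc-reverse {a ∷ l} (a≥l ∷ desc) rewrite Listₚ.unfold-reverse a l =
  Asc-∷ʳ (Desc-reverse desc) (All-resp-↭ (↭-sym (Permₚ.↭-reverse l)) a≥l)

_≟ₗ_ : (ν ρ : List ℕ) → Dec (ν ≡ ρ)
_≟ₗ_ = Listₚ.≡-dec _≟_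

BoundedPartition : ℕ → ℕ → List ℕ → Set
BoundedPartition n k ν = Desc ν × All (1 ≤_) ν × sum ν ≡ n × All (_≤ k) ν

oneTo-bounds : ∀ M → All (λ j → 1 ≤ j × j ≤ M) (oneTo M)
oneTo-bounds M = Allₚ.map⁺ (All.map (λ i<M → s≤s z≤n , i<M) (upTo-< M))

All-concatMap : ∀ {A B : Set} {P : B → Set} (g : A → List B) {xs} → All (λ a → All P (g a)) xs → All P (concatMap g xs)
All-concatMap g [] = []
All-concatMap g (p ∷ ps) = Allₚ.++⁺ p (All-concatMap g ps)

partsLE-bounded : ∀ f n k → All (BoundedPartition n k) (partsLE f n k)
partsLE-bounded f zero k = ([] , [] , refl , []) ∷ []
partsLE-bounded zero (suc n) k = []
partsLE-bounded (suc f) (suc n) k = All-concatMap _ (All.map (λ {j} j-bounds →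
  Allₚ.map⁺ (All.map (λ {ν} → extend j ν j-bounds) (partsLE-bounded f (suc n ∸ j) j))) (oneTo-bounds (k ⊓ suc n)))
  where
  extend : ∀ j ν → 1 ≤ j × j ≤ k ⊓ suc n → BoundedPartition (suc n ∸ j) j ν → BoundedPartition (suc n) k (j ∷ ν)
  extend j ν (1≤j , j≤) (desc , pos , sum≡ , ν≤j) =
    ν≤j ∷ desc , 1≤j ∷ pos , trans (cong (j ℕ.+_) sum≡) (ℕₚ.m+[n∸m]≡n (ℕₚ.≤-trans j≤ (ℕₚ.m⊓n≤n k (suc n)))) ,
    j≤k ∷ All.map (λ i≤j → ℕₚ.≤-trans i≤j j≤k) ν≤j
    where
    j≤k = ℕₚ.≤-trans j≤ (ℕₚ.m⊓n≤m k (suc n))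

∑-oneTo-indicator : ∀ M r (X : ℤ) → 1 ≤ r → r ≤ M → ∑[ j ∈ oneTo M ] (if j ≡ᵇ r then X else 0ℤ) ≡ X
∑-oneTo-indicator M (suc r) X _ r<M = trans (∑-map suc (upTo M) _)
  (trans (∑-cong (upTo M) (λ i → cong (λ b → if b then X else 0ℤ) (≡ᵇ-sym i r))) (∑-upTo-indicator M r (λ _ → X) r<M))
  where
  ≡ᵇ-sym : ∀ a b → (a ≡ᵇ b) ≡ (b ≡ᵇ a)
  ≡ᵇ-sym zero zero = refl
  ≡ᵇ-sym zero (suc b) = refl
  ≡ᵇ-sym (suc a) zero = refl
  ≡ᵇ-sym (suc a) (suc b) = ≡ᵇ-sym a b

∑-partsLE-indicator : ∀ f n k ρ (h : List ℕ → ℤ) → BoundedPartition n k ρ → n ≤ f →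
  ∑[ ν ∈ partsLE f n k ] (if does (ν ≟ₗ ρ) then h ν else 0ℤ) ≡ h ρ
∑-partsLE-indicator f zero k [] h _ _ = ℤₚ.+-identityʳ (h [])
∑-partsLE-indicator f zero k (r ∷ ρ) h (_ , (1≤r ∷ _) , sum≡0 , _) _ =
  ⊥-elim (ℕₚ.<-irrefl refl (ℕₚ.≤-trans 1≤r (ℕₚ.≤-trans (ℕₚ.m≤m+n r (sum ρ)) (ℕₚ.≤-reflexive sum≡0))))
∑-partsLE-indicator zero (suc n) k ρ h _ ()
∑-partsLE-indicator (suc f) (suc n) k [] h (_ , _ , () , _) _
∑-partsLE-indicator (suc f) (suc n) k (r ∷ ρ) h ((r≥ρ ∷ desc) , (1≤r ∷ pos) , sum≡ , (r≤k ∷ ρ≤k)) (s≤s n≤f) =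
  trans (∑-concatMap _ (oneTo (k ⊓ suc n)) _) (trans (∑-cong (oneTo (k ⊓ suc n)) first-part)
    (∑-oneTo-indicator (k ⊓ suc n) r _ 1≤r (ℕₚ.⊓-glb r≤k r≤1+n)))
  where
  r≤1+n : r ≤ suc n
  r≤1+n = ℕₚ.≤-trans (ℕₚ.m≤m+n r (sum ρ)) (ℕₚ.≤-reflexive sum≡)
  rest : ∑[ ν ∈ partsLE f (suc n ∸ r) r ] (if does (ν ≟ₗ ρ) then h (r ∷ ν) else 0ℤ) ≡ h (r ∷ ρ)
  rest = ∑-partsLE-indicator f (suc n ∸ r) r ρ (λ ν → h (r ∷ ν))
    (desc , pos , trans (sym (ℕₚ.m+n∸m≡n r (sum ρ))) (cong (ℕ._∸ r) sum≡) , r≥ρ)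
    (ℕₚ.≤-trans (ℕₚ.∸-monoʳ-≤ (suc n) 1≤r) n≤f)
  first-part : ∀ j → ∑ (map (j ∷_) (partsLE f (suc n ∸ j) j)) (λ ν → if does (ν ≟ₗ (r ∷ ρ)) then h ν else 0ℤ)
                     ≡ (if j ≡ᵇ r then h (r ∷ ρ) else 0ℤ)
  first-part j with j ≡ᵇ r in eq
  ... | true rewrite ≡ᵇ-true⁻¹ {j} eq = trans (∑-map (r ∷_) (partsLE f (suc n ∸ r) r) _)
    (trans (∑-cong (partsLE f (suc n ∸ r) r) (λ ν → cong (λ b → if b ∧ does (ν ≟ₗ ρ) then h (r ∷ ν) else 0ℤ) (≡ᵇ-refl r))) rest)
  ... | false = trans (∑-map (j ∷_) (partsLE f (suc n ∸ j) j) _)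
    (∑-zero (partsLE f (suc n ∸ j) j) (λ ν → cong (λ b → if b ∧ does (ν ≟ₗ ρ) then h (j ∷ ν) else 0ℤ) eq))

a+b≡x+[a+0]⇒b≡x : ∀ {a b x} → a ℕ.+ b ≡ x ℕ.+ (a ℕ.+ 0) → b ≡ x
a+b≡x+[a+0]⇒b≡x {a} {b} {x} eq = ℕₚ.+-cancelˡ-≡ a b x (trans eq (swap x a))
  where
  swap : ∀ x a → x ℕ.+ (a ℕ.+ 0) ≡ a ℕ.+ x
  swap = solve-∀ℕ

no-contribution : ∀ β → 0ℤ ≡ 0ℤ + (if β then 0ℤ else 0ℤ)
no-contribution β = sym (trans (ℤₚ.+-identityˡ _) (if-same β 0ℤ))

sort-pair : ∀ x y → (y ≤ x × sort (x ∷ y ∷ []) ≡ x ∷ y ∷ []) ⊎ (x < y × sort (x ∷ y ∷ []) ≡ y ∷ x ∷ [])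
sort-pair x y with y ≤? x
... | yes y≤x = inj₁ (y≤x , cong (λ β → if β then x ∷ y ∷ [] else y ∷ x ∷ []) (≤ᵇ-true y≤x))
... | no y≰x = inj₂ (ℕₚ.≰⇒> y≰x , cong (λ β → if β then x ∷ y ∷ [] else y ∷ x ∷ []) (≤ᵇ-false y≰x))

sort-twoParts : ∀ {a b} e ν → a ≤ b → a ℕ.+ b ≡ suc e ℕ.+ sum ν →
  (if does (sort (suc e ∷ ν) ≟ₗ (b ∷ a ∷ [])) then 1ℤ else 0ℤ) ≡ isSingle a ν + (if a ≡ᵇ b then 0ℤ else isSingle b ν)
sort-twoParts {a} {b} e [] _ _ rewrite Boolₚ.∧-zeroʳ (suc e ≡ᵇ b) = no-contribution (a ≡ᵇ b)
sort-twoParts {a} {b} e (j ∷ k ∷ ν) _ _ =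
  trans (cong (λ β → if β then 1ℤ else 0ℤ) (dec-false (sort (suc e ∷ j ∷ k ∷ ν) ≟ₗ (b ∷ a ∷ [])) too-long))
        (no-contribution (a ≡ᵇ b))
  where
  too-long : ¬ sort (suc e ∷ j ∷ k ∷ ν) ≡ b ∷ a ∷ []
  too-long eq with trans (sym (cong length eq)) (↭-length (sort-↭ (suc e ∷ j ∷ k ∷ ν)))
  ... | ()
sort-twoParts {a} {b} e (j ∷ []) a≤b a+b≡ with j ≟ a | j ≟ b
... | yes refl | _ = begin
  (if does (sort (suc e ∷ a ∷ []) ≟ₗ (b ∷ a ∷ [])) then 1ℤ else 0ℤ)
    ≡⟨ cong (λ β → if β then 1ℤ else 0ℤ) (dec-true (sort (suc e ∷ a ∷ []) ≟ₗ (b ∷ a ∷ [])) sorted) ⟩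
  1ℤ
    ≡⟨ cong₂ _+_ (cong (λ β → if β then 1ℤ else 0ℤ) (≡ᵇ-refl a)) (no-second (a ≡ᵇ b)) ⟨
  isSingle a (a ∷ []) + (if a ≡ᵇ b then 0ℤ else isSingle b (a ∷ [])) ∎
  where
  open ≡-Reasoning
  x≡b : suc e ≡ b
  x≡b = sym (a+b≡x+[a+0]⇒b≡x a+b≡)
  sorted : sort (suc e ∷ a ∷ []) ≡ b ∷ a ∷ []
  sorted with sort-pair (suc e) a
  ... | inj₁ (_ , s≡) = trans s≡ (cong (_∷ a ∷ []) x≡b)
  ... | inj₂ (x<a , _) = ⊥-elim (ℕₚ.<⇒≱ x<a (subst (a ≤_) (sym x≡b) a≤b))
  no-second : ∀ β → (if β then 0ℤ else (if β then 1ℤ else 0ℤ)) ≡ 0ℤ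
  no-second true = refl
  no-second false = refl
... | no b≢a | yes refl = begin
  (if does (sort (suc e ∷ b ∷ []) ≟ₗ (b ∷ a ∷ [])) then 1ℤ else 0ℤ)
    ≡⟨ cong (λ β → if β then 1ℤ else 0ℤ) (dec-true (sort (suc e ∷ b ∷ []) ≟ₗ (b ∷ a ∷ [])) sorted) ⟩
  1ℤ
    ≡⟨ cong₂ _+_ (cong (λ β → if β then 1ℤ else 0ℤ) (≡ᵇ-false b≢a))
                 (trans (cong (λ β → if β then 0ℤ else isSingle b (b ∷ [])) (≡ᵇ-false (b≢a ∘ sym)))
                        (cong (λ β → if β then 1ℤ else 0ℤ) (≡ᵇ-refl b))) ⟨
  isSingle a (b ∷ []) + (if a ≡ᵇ b then 0ℤ else isSingle b (b ∷ [])) ∎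
  where
  open ≡-Reasoning
  x≡a : suc e ≡ a
  x≡a = sym (a+b≡x+[a+0]⇒b≡x (trans (ℕₚ.+-comm b a) a+b≡))
  sorted : sort (suc e ∷ b ∷ []) ≡ b ∷ a ∷ []
  sorted with sort-pair (suc e) b
  ... | inj₁ (b≤x , _) = ⊥-elim (b≢a (ℕₚ.≤-antisym (subst (b ≤_) x≡a b≤x) a≤b))
  ... | inj₂ (_ , s≡) = trans s≡ (cong (λ z → b ∷ z ∷ []) x≡a)
... | no j≢a | no j≢b = begin
  (if does (sort (suc e ∷ j ∷ []) ≟ₗ (b ∷ a ∷ [])) then 1ℤ else 0ℤ)
    ≡⟨ cong (λ β → if β then 1ℤ else 0ℤ) (dec-false (sort (suc e ∷ j ∷ []) ≟ₗ (b ∷ a ∷ [])) unsorted) ⟩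
  0ℤ
    ≡⟨ no-contribution (a ≡ᵇ b) ⟩
  0ℤ + (if a ≡ᵇ b then 0ℤ else 0ℤ)
    ≡⟨ cong₂ (λ β γ → (if β then 1ℤ else 0ℤ) + (if a ≡ᵇ b then 0ℤ else (if γ then 1ℤ else 0ℤ))) (≡ᵇ-false j≢a) (≡ᵇ-false j≢b) ⟨
  isSingle a (j ∷ []) + (if a ≡ᵇ b then 0ℤ else isSingle b (j ∷ [])) ∎
  where
  open ≡-Reasoning
  unsorted : ¬ sort (suc e ∷ j ∷ []) ≡ b ∷ a ∷ []
  unsorted eq with sort-pair (suc e) j
  ... | inj₁ (_ , s≡) = j≢a (Listₚ.∷-injectiveˡ (Listₚ.∷-injectiveʳ (trans (sym s≡) eq)))
  ... | inj₂ (_ , s≡) = j≢b (Listₚ.∷-injectiveˡ (trans (sym s≡) eq))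

parts≤sum : ∀ l → All (_≤ sum l) l
parts≤sum [] = []
parts≤sum (a ∷ l) = ℕₚ.m≤m+n a (sum l) ∷ All.map (λ p → ℕₚ.≤-trans p (ℕₚ.m≤n+m (sum l) a)) (parts≤sum l)

twoPartCount : List ℕ → ℕ → ℕ
twoPartCount legs a =
  countAtLeast a legs ℕ.+ (if a ≡ᵇ order legs ∸ a then 0 else countAtLeast (order legs ∸ a) legs)

module SpiderExpansion (legs : List ℕ) where

  private
    n = order legs
    E = spiderEdges legs
    F = spiderExpansion legs

  F-shapes : All (λ t → All (1 ≤_) (proj₂ t) × sum (proj₂ t) ≡ n) F
  F-shapes = Allₚ.map⁺ (All.map (λ (hom , pos) → (s≤s z≤n ∷ pos) , cong suc hom)
                                (All.zip (legsPoly-homogeneous legs , legsPoly-positive legs)))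

  sort-bounded : ∀ μ → All (1 ≤_) μ × sum μ ≡ n → BoundedPartition n n (sort μ)
  sort-bounded μ (pos , sum≡) = sort-desc μ , All-resp-↭ (↭-sym (sort-↭ μ)) pos , trans (sum-↭ (sort-↭ μ)) sum≡ ,
    All-resp-↭ (↭-sym (sort-↭ μ)) (All.map (λ p → ℕₚ.≤-trans p (ℕₚ.≤-reflexive sum≡)) (parts≤sum μ))

  coefficients : List ℕ → ℤ
  coefficients ν = ∑[ t ∈ F ] (if does (ν ≟ₗ sort (proj₂ t)) then proj₁ t else 0ℤ)

  coefficients-expansion : IsPowerSumExpansion n E coefficients
  coefficients-expansion x = sym (begin
    sumℤ (map (λ ν → coefficients ν * P ν) (partitions n))
      ≡⟨ sumℤ-map (partitions n) _ ⟩
    ∑[ ν ∈ partitions n ] (coefficients ν * P ν)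
      ≡⟨ ∑-cong (partitions n) (λ ν → trans (sym (∑-*ʳ F (P ν) _)) (∑-cong F (λ t → if-*ʳ _ (proj₁ t) (P ν)))) ⟩
    ∑[ ν ∈ partitions n ] ∑[ t ∈ F ] (if does (ν ≟ₗ sort (proj₂ t)) then proj₁ t * P ν else 0ℤ)
      ≡⟨ ∑-swap (partitions n) F _ ⟩
    ∑[ t ∈ F ] ∑[ ν ∈ partitions n ] (if does (ν ≟ₗ sort (proj₂ t)) then proj₁ t * P ν else 0ℤ)
      ≡⟨ ∑-cong-All (All.map (λ {t} shape → ∑-partsLE-indicator n n n (sort (proj₂ t)) (λ ν → proj₁ t * P ν)
                                               (sort-bounded (proj₂ t) shape) ℕₚ.≤-refl) F-shapes) ⟩
    ∑[ t ∈ F ] (proj₁ t * P (sort (proj₂ t)))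
      ≡⟨ ∑-cong F (λ t → cong (proj₁ t *_) (pν-↭ n x (sort-↭ (proj₂ t)))) ⟩
    ⟦ F ⟧ P
      ≡⟨ chromX-spider legs x ⟨
    chromX n E x ∎)
    where
    open ≡-Reasoning
    P : List ℕ → ℤ
    P ν = pν n ν x

  module _ (c : List ℕ → ℤ) (expansion : IsPowerSumExpansion n E c) where

    -- The difference of the two expansions, written with ascending shapes.
    difference : Combination
    difference = map (λ ν → (c ν , reverse ν)) (partitions n) ++ map (λ t → (- proj₁ t , reverse (sort (proj₂ t)))) F

    difference-admissible : Admissible n difference
    difference-admissible = Allₚ.++⁺
      (Allₚ.map⁺ (All.map (λ {ν} → ascending ν) (partsLE-bounded n n n)))
      (Allₚ.map⁺ (All.map (λ {t} shape → ascending (sort (proj₂ t)) (sort-bounded (proj₂ t) shape)) F-shapes))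
      where
      ascending : ∀ ν → BoundedPartition n n ν → IsAscPartition≤ n (reverse ν)
      ascending ν (desc , pos , sum≡ , _) =
        Desc-reverse desc , All-resp-↭ (↭-sym (↭-reverse ν)) pos , ℕₚ.≤-reflexive (trans (sum-↭ (↭-reverse ν)) sum≡)

    ⟦difference⟧ : ∀ h → ⟦ difference ⟧ (h ∘ reverse) ≡
      ∑[ ν ∈ partitions n ] (c ν * h ν) - ∑[ t ∈ F ] (proj₁ t * h (sort (proj₂ t)))
    ⟦difference⟧ h = trans (∑-++ (map _ (partitions n)) (map _ F) _) (cong₂ _+_
      (trans (∑-map _ (partitions n) _) (∑-cong (partitions n) (λ ν → cong (λ μ → c ν * h μ) (Listₚ.reverse-involutive ν))))
      (trans (∑-map _ F _) (trans (∑-cong F (λ t → trans (cong (λ μ → - proj₁ t * h μ) (Listₚ.reverse-involutive _))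
                                                          (sym (ℤₚ.neg-distribˡ-* (proj₁ t) _))))
                                  (∑-neg F _))))

    difference-vanishes : ∀ x → ⟦ difference ⟧ (λ ν → pν n ν x) ≡ 0ℤ
    difference-vanishes x = begin
      ⟦ difference ⟧ (λ ν → pν n ν x)
        ≡⟨ ⟦⟧-cong-All difference difference-admissible (λ ν _ → pν-↭ n x (↭-sym (↭-reverse ν))) ⟩
      ⟦ difference ⟧ ((λ ν → pν n ν x) ∘ reverse)
        ≡⟨ ⟦difference⟧ (λ ν → pν n ν x) ⟩
      ∑[ ν ∈ partitions n ] (c ν * pν n ν x) - ∑[ t ∈ F ] (proj₁ t * pν n (sort (proj₂ t)) x)
        ≡⟨ cong₂ _-_ (trans (sym (sumℤ-map (partitions n) _)) (sym (expansion x)))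
                     (trans (∑-cong F (λ t → cong (proj₁ t *_) (pν-↭ n x (sort-↭ (proj₂ t))))) (sym (chromX-spider legs x))) ⟩
      chromX n E x - chromX n E x
        ≡⟨ ℤₚ.+-inverseʳ (chromX n E x) ⟩
      0ℤ ∎
      where open ≡-Reasoning

    coefficients-determined : ∀ h → ∑[ ν ∈ partitions n ] (c ν * h ν) ≡ ∑[ t ∈ F ] (proj₁ t * h (sort (proj₂ t)))
    coefficients-determined h = ℤₚ.i-j≡0⇒i≡j _ _ (trans (sym (⟦difference⟧ h))
      (powerSums-independent n difference difference-admissible difference-vanishes (h ∘ reverse)))

    twoPart-coefficient : ∀ a → 1 ≤ a → a ≤ n ∸ a → c ((n ∸ a) ∷ a ∷ []) ≡ - sgnAll legs * + twoPartCount legs a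
    twoPart-coefficient a 1≤a a≤b = begin
      c (b ∷ a ∷ [])
        ≡⟨ ℤₚ.*-identityʳ _ ⟨
      c (b ∷ a ∷ []) * 1ℤ
        ≡⟨ ∑-partsLE-indicator n n n (b ∷ a ∷ []) (λ ν → c ν * 1ℤ) bounded ℕₚ.≤-refl ⟨
      ∑[ ν ∈ partitions n ] (if does (ν ≟ₗ (b ∷ a ∷ [])) then c ν * 1ℤ else 0ℤ)
        ≡⟨ ∑-cong (partitions n) (λ ν → sym (if-*ˡ _ (c ν) 1ℤ)) ⟩
      ∑[ ν ∈ partitions n ] (c ν * is-ba ν)
        ≡⟨ coefficients-determined is-ba ⟩
      ∑[ t ∈ F ] (proj₁ t * is-ba (sort (proj₂ t)))
        ≡⟨ ∑-map _ (legsPoly legs) _ ⟩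
      ∑[ t ∈ legsPoly legs ] (coef t * is-ba (sort (suc (zdeg t) ∷ parts t)))
        ≡⟨ ∑-cong-All (All.map (λ {t} hom → cong (coef t *_) (sort-twoParts (zdeg t) (parts t) a≤b
                                                  (trans a+b≡n (cong suc (sym hom))))) (legsPoly-homogeneous legs)) ⟩
      ∑[ t ∈ legsPoly legs ] (coef t * (isSingle a (parts t) + (if a ≡ᵇ b then 0ℤ else isSingle b (parts t))))
        ≡⟨ distribute (a ≡ᵇ b) ⟩
      ⟪ legsPoly legs ⟫ (isSingle a) + (if a ≡ᵇ b then 0ℤ else ⟪ legsPoly legs ⟫ (isSingle b))
        ≡⟨ evaluate 1≤a (ℕₚ.≤-trans 1≤a a≤b) (a ≡ᵇ b) ⟩
      - sgnAll legs * + twoPartCount legs a ∎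
      where
      open ≡-Reasoning
      b = n ∸ a
      a+b≡n : a ℕ.+ b ≡ n
      a+b≡n = ℕₚ.m+[n∸m]≡n (ℕₚ.≤-trans a≤b (ℕₚ.m∸n≤m n a))
      bounded : BoundedPartition n n (b ∷ a ∷ [])
      bounded = ((a≤b ∷ []) ∷ [] ∷ []) , (ℕₚ.≤-trans 1≤a a≤b ∷ 1≤a ∷ []) ,
        trans (cong (b ℕ.+_) (ℕₚ.+-identityʳ a)) (trans (ℕₚ.+-comm b a) a+b≡n) , (ℕₚ.m∸n≤m n a ∷ ℕₚ.≤-trans (ℕₚ.m≤m+n a b) (ℕₚ.≤-reflexive a+b≡n) ∷ [])
      is-ba : List ℕ → ℤ
      is-ba ν = if does (ν ≟ₗ (b ∷ a ∷ [])) then 1ℤ else 0ℤ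
      Q = legsPoly legs
      distribute : ∀ β → ∑[ t ∈ Q ] (coef t * (isSingle a (parts t) + (if β then 0ℤ else isSingle b (parts t))))
                          ≡ ⟪ Q ⟫ (isSingle a) + (if β then 0ℤ else ⟪ Q ⟫ (isSingle b))
      distribute true = trans (∑-cong Q (λ t → cong (coef t *_) (ℤₚ.+-identityʳ _))) (sym (ℤₚ.+-identityʳ _))
      distribute false = trans (∑-cong Q (λ t → ℤₚ.*-distribˡ-+ (coef t) _ _)) (∑-+ Q _ _)
      evaluate : ∀ {a b} → 1 ≤ a → 1 ≤ b → ∀ β → ⟪ Q ⟫ (isSingle a) + (if β then 0ℤ else ⟪ Q ⟫ (isSingle b))
                 ≡ - sgnAll legs * + (countAtLeast a legs ℕ.+ (if β then 0 else countAtLeast b legs))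
      evaluate {suc a} {suc b} _ _ true rewrite ⟪legsPoly⟫-isSingle a legs =
        trans (ℤₚ.+-identityʳ _) (cong (λ k → - sgnAll legs * + k) (sym (ℕₚ.+-identityʳ _)))
      evaluate {suc a} {suc b} _ _ false rewrite ⟪legsPoly⟫-isSingle a legs | ⟪legsPoly⟫-isSingle b legs =
        trans (sym (ℤₚ.*-distribˡ-+ (- sgnAll legs) _ _)) (cong (- sgnAll legs *_) (sym (ℤₚ.pos-+ (countAtLeast (suc a) legs) (countAtLeast (suc b) legs))))

    dval-spider : ∀ a → 1 ≤ a → a ≤ n ∸ a → dval n c a ≡ twoPartCount legs a
    dval-spider a 1≤a a≤b = begin
      ∣ c ((n ∸ a) ∷ a ∷ []) ∣                        ≡⟨ cong ∣_∣ (twoPart-coefficient a 1≤a a≤b) ⟩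
      ∣ - sgnAll legs * + twoPartCount legs a ∣       ≡⟨ ℤₚ.abs-* (- sgnAll legs) _ ⟩
      ∣ - sgnAll legs ∣ ℕ.* twoPartCount legs a       ≡⟨ cong (ℕ._* twoPartCount legs a) (trans (ℤₚ.∣-i∣≡∣i∣ (sgnAll legs)) (∣sgnAll∣ legs)) ⟩
      1 ℕ.* twoPartCount legs a                       ≡⟨ ℕₚ.*-identityˡ _ ⟩
      twoPartCount legs a                             ∎
      where open ≡-Reasoning

-- Conjugate partitions

mult-++ : ∀ v A B → mult v (A ++ B) ≡ mult v A ℕ.+ mult v B
mult-++ v [] B = refl
mult-++ v (x ∷ A) B = trans (cong ((if x ≡ᵇ v then 1 else 0) ℕ.+_) (mult-++ v A B)) (sym (ℕₚ.+-assoc _ (mult v A) (mult v B)))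

mult-split : ∀ a B → 1 ≤ mult a B → Σ (List ℕ) (λ B₁ → Σ (List ℕ) (λ B₂ → B ≡ B₁ ++ a ∷ B₂))
mult-split a (x ∷ B) occurs with x ≟ a
... | yes refl = [] , B , refl
... | no x≢a rewrite ≡ᵇ-false x≢a with mult-split a B occurs
... | B₁ , B₂ , eq = x ∷ B₁ , B₂ , cong (x ∷_) eq

↭-mult : ∀ A B → (∀ v → mult v A ≡ mult v B) → A ↭ B
↭-mult [] [] _ = _↭_.refl
↭-mult [] (b ∷ B) same with trans (same b) (cong (ℕ._+ mult b B) (cong (λ β → if β then 1 else 0) (≡ᵇ-refl b)))
... | ()
↭-mult (a ∷ A) B same with mult-split a B (subst (1 ≤_) (trans (sym (mult-head a A)) (same a)) (s≤s z≤n))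
... | B₁ , B₂ , refl = ↭-trans (prep a (↭-mult A (B₁ ++ B₂) same-rest)) (↭-sym (shift a B₁ B₂))
  where
  same-rest : ∀ v → mult v A ≡ mult v (B₁ ++ B₂)
  same-rest v = ℕₚ.+-cancelˡ-≡ (if a ≡ᵇ v then 1 else 0) _ _ (begin
    (if a ≡ᵇ v then 1 else 0) ℕ.+ mult v A             ≡⟨ same v ⟩
    mult v (B₁ ++ a ∷ B₂)                               ≡⟨ mult-++ v B₁ (a ∷ B₂) ⟩
    mult v B₁ ℕ.+ ((if a ≡ᵇ v then 1 else 0) ℕ.+ mult v B₂) ≡⟨ swap (mult v B₁) _ (mult v B₂) ⟩
    (if a ≡ᵇ v then 1 else 0) ℕ.+ (mult v B₁ ℕ.+ mult v B₂) ≡⟨ cong (_ ℕ.+_) (mult-++ v B₁ B₂) ⟨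
    (if a ≡ᵇ v then 1 else 0) ℕ.+ mult v (B₁ ++ B₂)    ∎)
    where
    open ≡-Reasoning
    swap : ∀ x y z → x ℕ.+ (y ℕ.+ z) ≡ y ℕ.+ (x ℕ.+ z)
    swap = solve-∀ℕ

countAtLeast-split : ∀ v l → countAtLeast v l ≡ mult v l ℕ.+ countAtLeast (suc v) l
countAtLeast-split v [] = refl
countAtLeast-split v (x ∷ l) rewrite atLeast-split v x | countAtLeast-split v l =
  interchange (if x ≡ᵇ v then 1 else 0) (atLeast (suc v) x) (mult v l) (countAtLeast (suc v) l)
  where
  interchange : ∀ a b c d → a ℕ.+ b ℕ.+ (c ℕ.+ d) ≡ a ℕ.+ c ℕ.+ (b ℕ.+ d)
  interchange = solve-∀ℕ

↭-countAtLeast : ∀ A B → All (1 ≤_) A → All (1 ≤_) B → (∀ i → countAtLeast (suc i) A ≡ countAtLeast (suc i) B) → A ↭ B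
↭-countAtLeast A B posA posB same = ↭-mult A B (λ v → ℕₚ.+-cancelʳ-≡ (countAtLeast (suc v) A) (mult v A) (mult v B)
  (trans (sym (countAtLeast-split v A)) (trans (same₀ v) (trans (countAtLeast-split v B) (cong (mult v B ℕ.+_) (sym (same v)))))))
  where
  countAtLeast-0 : ∀ {l} → All (1 ≤_) l → countAtLeast 0 l ≡ countAtLeast 1 l
  countAtLeast-0 [] = refl
  countAtLeast-0 {suc x ∷ l} (_ ∷ pos) = cong suc (countAtLeast-0 pos)
  same₀ : ∀ v → countAtLeast v A ≡ countAtLeast v B
  same₀ zero = trans (countAtLeast-0 posA) (trans (same 0) (sym (countAtLeast-0 posB)))
  same₀ (suc v) = same v

partAt : List ℕ → ℕ → ℕ
partAt [] _ = 0
partAt (a ∷ l) zero = a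
partAt (a ∷ l) (suc i) = partAt l i

partAt-All : ∀ {P : ℕ → Set} l i → All P l → P 0 → P (partAt l i)
partAt-All [] i [] p0 = p0
partAt-All (a ∷ l) zero (pa ∷ _) _ = pa
partAt-All (a ∷ l) (suc i) (_ ∷ pl) p0 = partAt-All l i pl p0

partAt-≤-head : ∀ {a l} i → All (_≤ a) l → partAt (a ∷ l) i ≤ a
partAt-≤-head zero _ = ℕₚ.≤-refl
partAt-≤-head {l = l} (suc i) l≤a = partAt-All l i l≤a z≤n

length-filter-≤ : ∀ i μ → length (filter (i ≤?_) μ) ≡ countAtLeast i μ
length-filter-≤ i [] = refl
length-filter-≤ i (a ∷ μ) with i ≤? a
... | yes i≤a rewrite ≤ᵇ-true i≤a = cong suc (length-filter-≤ i μ)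
... | no i≰a rewrite ≤ᵇ-false i≰a = length-filter-≤ i μ

countAtLeast-<-zero : ∀ k {l} → All (_< k) l → countAtLeast k l ≡ 0
countAtLeast-<-zero k [] = refl
countAtLeast-<-zero k {x ∷ l} (x<k ∷ rest) rewrite ≤ᵇ-false (ℕₚ.<⇒≱ x<k) = countAtLeast-<-zero k rest

atLeast-countAtLeast : ∀ {μ} → Desc μ → ∀ i k → atLeast (suc i) (countAtLeast (suc k) μ) ≡ atLeast (suc k) (partAt μ i)
atLeast-countAtLeast [] i k = refl
atLeast-countAtLeast {a ∷ l} (a≥l ∷ desc) i k with suc k ≤? a
atLeast-countAtLeast {a ∷ l} (a≥l ∷ desc) zero k | yes k<a rewrite ≤ᵇ-true k<a = refl
atLeast-countAtLeast {a ∷ l} (a≥l ∷ desc) (suc i) k | yes k<a rewrite ≤ᵇ-true k<a =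
  trans (sym (atLeast-suc (suc i) (countAtLeast (suc k) l))) (atLeast-countAtLeast desc i k)
... | no k≮a rewrite ≤ᵇ-false k≮a | countAtLeast-<-zero (suc k) (All.map (λ b≤a → ℕₚ.≤-<-trans b≤a (ℕₚ.≰⇒> k≮a)) a≥l) =
  sym (trans (cong (λ β → if β then 1 else 0) (≤ᵇ-false (λ k<p → k≮a (ℕₚ.≤-trans k<p (partAt-≤-head i a≥l)))))
    (sym (cong (λ β → if β then 1 else 0) (≤ᵇ-false {suc i} {0} (λ ())))))

countAtLeast-map : ∀ j (g : ℕ → ℕ) xs → countAtLeast j (map g xs) ≡ sum (map (atLeast j ∘ g) xs)
countAtLeast-map j g [] = refl
countAtLeast-map j g (x ∷ xs) = cong (atLeast j (g x) ℕ.+_) (countAtLeast-map j g xs)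

oneTo-suc : ∀ M → oneTo (suc M) ≡ 1 ∷ map suc (oneTo M)
oneTo-suc M = cong (λ l → 1 ∷ map suc l) (sym (Listₚ.map-upTo suc M))

sum-atLeast-oneTo : ∀ M v → sum (map (λ k → atLeast k v) (oneTo M)) ≡ M ⊓ v
sum-atLeast-oneTo zero v = refl
sum-atLeast-oneTo (suc M) v = trans (cong (λ l → sum (map (λ k → atLeast k v) l)) (oneTo-suc M)) (shifted v)
  where
  shifted : ∀ v → sum (map (λ k → atLeast k v) (1 ∷ map suc (oneTo M))) ≡ suc M ⊓ v
  shifted zero = none (oneTo M)
    where
    none : ∀ xs → sum (map (λ k → atLeast k 0) (map suc xs)) ≡ 0
    none [] = refl
    none (_ ∷ xs) = none xs
  shifted (suc v) = cong suc (trans (cong sum (trans (sym (Listₚ.map-∘ (oneTo M))) (Listₚ.map-cong (λ k → sym (atLeast-suc k v)) (oneTo M))))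
    (sum-atLeast-oneTo M v))

maxℕ-head : ∀ {a l} → All (_≤ a) l → maxℕ (a ∷ l) ≡ a
maxℕ-head {a} l≤a = ℕₚ.m≥n⇒m⊔n≡m (≤a l≤a)
  where
  ≤a : ∀ {l} → All (_≤ a) l → maxℕ l ≤ a
  ≤a [] = z≤n
  ≤a (b≤a ∷ rest) = ℕₚ.⊔-lub b≤a (≤a rest)

partAt-≤-maxℕ : ∀ {μ} → Desc μ → ∀ i → partAt μ i ≤ maxℕ μ
partAt-≤-maxℕ [] i = z≤n
partAt-≤-maxℕ (a≥l ∷ _) i = ℕₚ.≤-trans (partAt-≤-head i a≥l) (ℕₚ.≤-reflexive (sym (maxℕ-head a≥l)))

countAtLeast-conjugate : ∀ {μ} → Desc μ → ∀ i → countAtLeast (suc i) (conjugate μ) ≡ partAt μ i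
countAtLeast-conjugate {μ} desc i = begin
  countAtLeast (suc i) (conjugate μ)
    ≡⟨ countAtLeast-map (suc i) _ (oneTo (maxℕ μ)) ⟩
  sum (map (λ k → atLeast (suc i) (length (filter (k ≤?_) μ))) (oneTo (maxℕ μ)))
    ≡⟨ cong sum (Listₚ.map-cong-local (All.map (λ {k} bounds → by-part k bounds) (oneTo-bounds (maxℕ μ)))) ⟩
  sum (map (λ k → atLeast k (partAt μ i)) (oneTo (maxℕ μ)))
    ≡⟨ sum-atLeast-oneTo (maxℕ μ) (partAt μ i) ⟩
  maxℕ μ ⊓ partAt μ i
    ≡⟨ ℕₚ.m≥n⇒m⊓n≡n (partAt-≤-maxℕ desc i) ⟩
  partAt μ i ∎
  where
  open ≡-Reasoning
  by-part : ∀ k → 1 ≤ k × k ≤ maxℕ μ → atLeast (suc i) (length (filter (k ≤?_) μ)) ≡ atLeast k (partAt μ i)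
  by-part (suc k) _ = trans (cong (atLeast (suc i)) (length-filter-≤ (suc k) μ)) (atLeast-countAtLeast desc i k)

conjugate-positive : ∀ {μ} → Desc μ → All (1 ≤_) (conjugate μ)
conjugate-positive [] = []
conjugate-positive {a ∷ l} (a≥l ∷ _) = Allₚ.map⁺ (All.map positive (oneTo-bounds (maxℕ (a ∷ l))))
  where
  positive : ∀ {k} → 1 ≤ k × k ≤ maxℕ (a ∷ l) → 1 ≤ length (filter (k ≤?_) (a ∷ l))
  positive {k} (_ , k≤max) with k ≤? a
  ... | yes k≤a rewrite length-filter-≤ k (a ∷ l) | ≤ᵇ-true k≤a = s≤s z≤n
  ... | no k≰a = ⊥-elim (k≰a (ℕₚ.≤-trans k≤max (ℕₚ.≤-reflexive (maxℕ-head a≥l))))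

↭-conjugate : ∀ {legs μ} → All (1 ≤_) legs → Desc μ → (∀ i → countAtLeast (suc i) legs ≡ partAt μ i) → legs ↭ conjugate μ
↭-conjugate {legs} {μ} pos desc counts =
  ↭-countAtLeast legs (conjugate μ) pos (conjugate-positive desc) (λ i → trans (counts i) (sym (countAtLeast-conjugate desc i)))

prefixShape : (ℕ → ℕ) → ℕ → ℕ → List ℕ
prefixShape d t R = applyUpTo (d ∘ suc) t ++ replicate R 1

Desc-applyUpTo-++ : ∀ t (f : ℕ → ℕ) B → (∀ i j → i ≤ j → j < t → f j ≤ f i) → Desc B → (∀ i → i < t → All (_≤ f i) B) →
  Desc (applyUpTo f t ++ B)
Desc-applyUpTo-++ zero f B _ descB _ = descB
Desc-applyUpTo-++ (suc t) f B antitone descB B≤f =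
  Allₚ.++⁺ (Allₚ.applyUpTo⁺₁ (f ∘ suc) t (λ i<t → antitone 0 (suc _) z≤n (s≤s i<t))) (B≤f 0 (s≤s z≤n))
  ∷ Desc-applyUpTo-++ t (f ∘ suc) B (λ i j i≤j j<t → antitone (suc i) (suc j) (s≤s i≤j) (s≤s j<t)) descB (λ i i<t → B≤f (suc i) (s≤s i<t))

prefixShape-desc : ∀ d t R → (∀ i j → 1 ≤ i → i ≤ j → j ≤ t → d j ≤ d i) → R ≡ 0 ⊎ 1 ≤ d t → Desc (prefixShape d t R)
prefixShape-desc d t R antitone ones = Desc-applyUpTo-++ t (d ∘ suc) (replicate R 1)
  (λ i j i≤j j<t → antitone (suc i) (suc j) (s≤s z≤n) (s≤s i≤j) j<t) (ones-desc R)
  (λ i i<t → ones-below ones i i<t)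
  where
  ones-desc : ∀ R → Desc (replicate R 1)
  ones-desc zero = []
  ones-desc (suc R) = Allₚ.replicate⁺ R ℕₚ.≤-refl ∷ ones-desc R
  ones-below : R ≡ 0 ⊎ 1 ≤ d t → ∀ i → i < t → All (_≤ d (suc i)) (replicate R 1)
  ones-below (inj₁ refl) i i<t = []
  ones-below (inj₂ 1≤dt) i i<t = Allₚ.replicate⁺ R (ℕₚ.≤-trans 1≤dt (antitone (suc i) t (s≤s z≤n) i<t ℕₚ.≤-refl))

partAt-applyUpTo-++ˡ : ∀ t (f : ℕ → ℕ) B {i} → i < t → partAt (applyUpTo f t ++ B) i ≡ f i
partAt-applyUpTo-++ˡ (suc t) f B {zero} _ = refl
partAt-applyUpTo-++ˡ (suc t) f B {suc i} (s≤s i<t) = partAt-applyUpTo-++ˡ t (f ∘ suc) B i<t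

partAt-applyUpTo-++ʳ : ∀ t (f : ℕ → ℕ) B {i} → t ≤ i → partAt (applyUpTo f t ++ B) i ≡ partAt B (i ∸ t)
partAt-applyUpTo-++ʳ zero f B _ = refl
partAt-applyUpTo-++ʳ (suc t) f B {suc i} (s≤s t≤i) = partAt-applyUpTo-++ʳ t (f ∘ suc) B t≤i

partAt-replicate : ∀ R {j} → partAt (replicate R 1) j ≡ (if j <ᵇ R then 1 else 0)
partAt-replicate zero {j} = refl
partAt-replicate (suc R) {zero} = refl
partAt-replicate (suc R) {suc j} = partAt-replicate R

↭-prefixShape : ∀ {legs} d t R T → t ℕ.+ R ≡ T → All (1 ≤_) legs → Desc (prefixShape d t R) →
  (∀ i → i < t → countAtLeast (suc i) legs ≡ d (suc i)) →
  (∀ i → t ≤ i → i < T → countAtLeast (suc i) legs ≡ 1) →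
  (∀ i → T ≤ i → countAtLeast (suc i) legs ≡ 0) →
  legs ↭ conjugate (prefixShape d t R)
↭-prefixShape {legs} d t R T refl pos desc head middle tail = ↭-conjugate pos desc counts
  where
  counts : ∀ i → countAtLeast (suc i) legs ≡ partAt (prefixShape d t R) i
  counts i with i <? t
  ... | yes i<t = trans (head i i<t) (sym (partAt-applyUpTo-++ˡ t (d ∘ suc) (replicate R 1) i<t))
  ... | no i≮t with ℕₚ.≮⇒≥ i≮t
  ...   | t≤i = trans (in-range (i ∸ t <? R)) (sym (trans (partAt-applyUpTo-++ʳ t (d ∘ suc) (replicate R 1) t≤i)
                   (partAt-replicate R)))
    where
    i≡t+[i∸t] : i ≡ t ℕ.+ (i ∸ t)
    i≡t+[i∸t] = sym (ℕₚ.m+[n∸m]≡n t≤i)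
    in-range : Dec (i ∸ t < R) → countAtLeast (suc i) legs ≡ (if i ∸ t <ᵇ R then 1 else 0)
    in-range (yes in-R) rewrite <ᵇ-true in-R = middle i t≤i (subst (_< t ℕ.+ R) (sym i≡t+[i∸t]) (ℕₚ.+-monoʳ-< t in-R))
    in-range (no out-R) rewrite <ᵇ-false out-R =
      tail i (subst (t ℕ.+ R ≤_) (sym i≡t+[i∸t]) (ℕₚ.+-monoʳ-≤ t (ℕₚ.≮⇒≥ out-R)))

mu1-prefixShape : ∀ m d → mu1 m d ≡ prefixShape d m 0
mu1-prefixShape m d = trans (trans (sym (Listₚ.map-∘ (upTo m))) (Listₚ.map-upTo (d ∘ suc) m)) (sym (Listₚ.++-identityʳ _))

tailSum : (ℕ → ℕ) → ℕ → ℕ → ℕ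
tailSum d t zero = 0
tailSum d t (suc k) = tailSum d t k ℕ.+ d (t ℕ.+ suc k)

replicate-+ : ∀ a b → replicate (a ℕ.+ b) 1 ≡ replicate a 1 ++ replicate b 1
replicate-+ zero b = refl
replicate-+ (suc a) b = cong (1 ∷_) (replicate-+ a b)

oneTo-∷ʳ : ∀ k → oneTo (suc k) ≡ oneTo k ++ suc k ∷ []
oneTo-∷ʳ k = trans (cong (map suc) (sym (Listₚ.upTo-∷ʳ k))) (Listₚ.map-++ suc (upTo k) (k ∷ []))

ones-and-twos : ∀ d t k → (∀ j → 1 ≤ j → j ≤ k → d (t ℕ.+ j) ≡ 1 ⊎ d (t ℕ.+ j) ≡ 2) →
  concatMap (λ i → if d i ≡ᵇ 2 then 1 ∷ 1 ∷ [] else d i ∷ []) (map (t ℕ.+_) (oneTo k)) ≡ replicate (tailSum d t k) 1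
ones-and-twos d t zero _ = refl
ones-and-twos d t (suc k) one-or-two = begin
  concatMap split (map (t ℕ.+_) (oneTo (suc k)))
    ≡⟨ cong (λ l → concatMap split (map (t ℕ.+_) l)) (oneTo-∷ʳ k) ⟩
  concatMap split (map (t ℕ.+_) (oneTo k ++ suc k ∷ []))
    ≡⟨ cong (concatMap split) (Listₚ.map-++ (t ℕ.+_) (oneTo k) (suc k ∷ [])) ⟩
  concatMap split (map (t ℕ.+_) (oneTo k) ++ (t ℕ.+ suc k) ∷ [])
    ≡⟨ Listₚ.concatMap-++ split (map (t ℕ.+_) (oneTo k)) ((t ℕ.+ suc k) ∷ []) ⟩
  concatMap split (map (t ℕ.+_) (oneTo k)) ++ concatMap split ((t ℕ.+ suc k) ∷ [])
    ≡⟨ cong₂ _++_ (ones-and-twos d t k (λ j 1≤j j≤k → one-or-two j 1≤j (ℕₚ.m≤n⇒m≤1+n j≤k)))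
                  (last (one-or-two (suc k) (s≤s z≤n) ℕₚ.≤-refl)) ⟩
  replicate (tailSum d t k) 1 ++ replicate (d (t ℕ.+ suc k)) 1
    ≡⟨ replicate-+ (tailSum d t k) (d (t ℕ.+ suc k)) ⟨
  replicate (tailSum d t (suc k)) 1 ∎
  where
  open ≡-Reasoning
  split : ℕ → List ℕ
  split i = if d i ≡ᵇ 2 then 1 ∷ 1 ∷ [] else d i ∷ []
  last : d (t ℕ.+ suc k) ≡ 1 ⊎ d (t ℕ.+ suc k) ≡ 2 → concatMap split ((t ℕ.+ suc k) ∷ []) ≡ replicate (d (t ℕ.+ suc k)) 1
  last (inj₁ d≡1) rewrite d≡1 = refl
  last (inj₂ d≡2) rewrite d≡2 = refl

mu2-prefixShape : ∀ m d t → t ≤ m → (∀ i → t < i → i ≤ m → d i ≡ 1 ⊎ d i ≡ 2) →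
  mu2 m d t ≡ prefixShape d t (tailSum d t (m ∸ t))
mu2-prefixShape m d t t≤m one-or-two = cong₂ _++_ (trans (mu1-prefixShape t d) (Listₚ.++-identityʳ _))
  (ones-and-twos d t (m ∸ t) (λ j 1≤j j≤m∸t → one-or-two (t ℕ.+ j) (ℕₚ.m<m+n t 1≤j)
    (ℕₚ.≤-trans (ℕₚ.+-monoʳ-≤ t j≤m∸t) (ℕₚ.≤-reflexive (ℕₚ.m+[n∸m]≡n t≤m)))))

-- The vector d(T)

countAtLeast-anti : ∀ {i j} l → i ≤ j → countAtLeast j l ≤ countAtLeast i l
countAtLeast-anti [] _ = z≤n
countAtLeast-anti {i} {j} (x ∷ l) i≤j = ℕₚ.+-mono-≤ (atLeast-anti x) (countAtLeast-anti l i≤j)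
  where
  atLeast-anti : ∀ x → atLeast j x ≤ atLeast i x
  atLeast-anti x with j ≤? x
  ... | yes j≤x rewrite ≤ᵇ-true j≤x | ≤ᵇ-true (ℕₚ.≤-trans i≤j j≤x) = ℕₚ.≤-refl
  ... | no j≰x rewrite ≤ᵇ-false j≰x = z≤n

countAtLeast-++ : ∀ j A B → countAtLeast j (A ++ B) ≡ countAtLeast j A ℕ.+ countAtLeast j B
countAtLeast-++ j [] B = refl
countAtLeast-++ j (x ∷ A) B = trans (cong (atLeast j x ℕ.+_) (countAtLeast-++ j A B)) (sym (ℕₚ.+-assoc (atLeast j x) _ _))

parts<sum : ∀ {l} → All (1 ≤_) l → 2 ≤ length l → All (_< sum l) l
parts<sum {_ ∷ []} _ (s≤s ())
parts<sum {x ∷ y ∷ l} (1≤x ∷ 1≤y ∷ pos) _ =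
  ℕₚ.m<m+n x (ℕₚ.≤-trans 1≤y (ℕₚ.m≤m+n y (sum l))) ∷ All.map (λ z≤ → ℕₚ.<-≤-trans (s≤s z≤) (ℕₚ.+-monoˡ-≤ _ 1≤x)) (parts≤sum (y ∷ l))

module LegCounts (legs : List ℕ) (spider : IsSpiderLegs legs) where

  private
    n = order legs
    m = n / 2
    D = twoPartCount legs
    count : ℕ → ℕ
    count j = countAtLeast j legs

  positive : All (1 ≤_) legs
  positive = proj₂ spider

  parity : n ≡ m ℕ.+ m ⊎ n ≡ suc (m ℕ.+ m)
  parity with n % 2 | m%n<n n 2 | m≡m%n+[m/n]*n n 2
  ... | zero | _ | eq = inj₁ (trans eq (trans (ℕₚ.*-comm m 2) (cong (m ℕ.+_) (ℕₚ.+-identityʳ m))))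
  ... | suc zero | _ | eq = inj₂ (trans eq (cong suc (trans (ℕₚ.*-comm m 2) (cong (m ℕ.+_) (ℕₚ.+-identityʳ m)))))
  ... | suc (suc _) | s≤s (s≤s ()) | _

  2m≤n : m ℕ.+ m ≤ n
  2m≤n with parity
  ... | inj₁ n≡ = ℕₚ.≤-reflexive (sym n≡)
  ... | inj₂ n≡ = ℕₚ.≤-trans (ℕₚ.n≤1+n _) (ℕₚ.≤-reflexive (sym n≡))

  n≤2m+1 : n ≤ suc (m ℕ.+ m)
  n≤2m+1 with parity
  ... | inj₁ n≡ = ℕₚ.≤-trans (ℕₚ.≤-reflexive n≡) (ℕₚ.n≤1+n _)
  ... | inj₂ n≡ = ℕₚ.≤-reflexive n≡

  a+[n∸a]≡n : ∀ {a} → a ≤ m → a ℕ.+ (n ∸ a) ≡ n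
  a+[n∸a]≡n a≤m = ℕₚ.m+[n∸m]≡n (ℕₚ.≤-trans (ℕₚ.≤-trans a≤m (ℕₚ.m≤m+n m m)) 2m≤n)

  m≤n∸a : ∀ {a} → a ≤ m → m ≤ n ∸ a
  m≤n∸a {a} a≤m = ℕₚ.+-cancelˡ-≤ m m (n ∸ a)
    (ℕₚ.≤-trans 2m≤n (ℕₚ.≤-trans (ℕₚ.≤-reflexive (sym (a+[n∸a]≡n a≤m))) (ℕₚ.+-monoˡ-≤ (n ∸ a) a≤m)))

  a≤n∸a : ∀ {a} → a ≤ m → a ≤ n ∸ a
  a≤n∸a a≤m = ℕₚ.≤-trans a≤m (m≤n∸a a≤m)

  self-complementary : ∀ {a} → a ≤ m → a ≡ n ∸ a → a ≡ m
  self-complementary {a} a≤m a≡ with ℕₚ.m≤n⇒m<n∨m≡n a≤m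
  ... | inj₂ a≡m = a≡m
  ... | inj₁ a<m = ⊥-elim (ℕₚ.<⇒≱ (ℕₚ.+-mono-< a<m a<m) (ℕₚ.≤-trans 2m≤n
          (ℕₚ.≤-reflexive (trans (sym (a+[n∸a]≡n a≤m)) (cong (a ℕ.+_) (sym a≡))))))

  D-≢ : ∀ {a} → ¬ a ≡ n ∸ a → D a ≡ count a ℕ.+ count (n ∸ a)
  D-≢ a≢ rewrite ≡ᵇ-false a≢ = refl

  D-≡ : ∀ {a} → a ≡ n ∸ a → D a ≡ count a
  D-≡ a≡ rewrite ≡ᵇ-true a≡ = ℕₚ.+-identityʳ _

  D-no-complement : ∀ a → count (n ∸ a) ≡ 0 → D a ≡ count a
  D-no-complement a none with a ≟ n ∸ a
  ... | yes a≡ = D-≡ a≡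
  ... | no a≢ = trans (D-≢ a≢) (trans (cong (count a ℕ.+_) none) (ℕₚ.+-identityʳ _))

  complement≡m : ∀ {a} → a ≤ m → n ∸ a ≡ m → a ≡ m
  complement≡m {a} a≤m n∸a≡m = ℕₚ.≤-antisym a≤m (ℕₚ.+-cancelʳ-≤ m m a
    (ℕₚ.≤-trans 2m≤n (ℕₚ.≤-reflexive (trans (sym (a+[n∸a]≡n a≤m)) (cong (a ℕ.+_) n∸a≡m)))))

  module NoLongLeg (short : All (_≤ m) legs) where

    count-beyond : ∀ {j} → m < j → count j ≡ 0
    count-beyond m<j = countAtLeast-<-zero _ (All.map (λ l≤m → ℕₚ.≤-<-trans l≤m m<j) short)

    D≡count : ∀ {a} → a ≤ m → D a ≡ count a
    D≡count {a} a≤m with a ≟ n ∸ a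
    ... | yes a≡ = D-≡ a≡
    ... | no a≢ = D-no-complement a (count-beyond (ℕₚ.≤∧≢⇒< (m≤n∸a a≤m) m≢n∸a))
      where
      m≢n∸a : ¬ m ≡ n ∸ a
      m≢n∸a m≡ = a≢ (trans (complement≡m a≤m (sym m≡)) m≡)

  module LongLeg (pre : List ℕ) (L : ℕ) (post : List ℕ) (legs≡ : legs ≡ pre ++ L ∷ post) (m<L : m < L) where

    others = pre ++ post
    t₀ = sum others

    n≡ : n ≡ suc (L ℕ.+ t₀)
    n≡ = cong suc (trans (cong sum legs≡) (trans (sum-++ pre (L ∷ post))
      (trans (swap (sum pre) L (sum post)) (cong (L ℕ.+_) (sym (sum-++ pre post))))))
      where
      swap : ∀ a b c → a ℕ.+ (b ℕ.+ c) ≡ b ℕ.+ (a ℕ.+ c)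
      swap = solve-∀ℕ

    count-split : ∀ j → count j ≡ atLeast j L ℕ.+ countAtLeast j others
    count-split j = trans (cong (countAtLeast j) legs≡) (trans (countAtLeast-++ j pre (L ∷ post))
      (trans (swap (countAtLeast j pre) (atLeast j L) (countAtLeast j post)) (cong (atLeast j L ℕ.+_) (sym (countAtLeast-++ j pre post)))))
      where
      swap : ∀ a b c → a ℕ.+ (b ℕ.+ c) ≡ b ℕ.+ (a ℕ.+ c)
      swap = solve-∀ℕ

    others-positive : All (1 ≤_) others
    others-positive with Allₚ.++⁻ pre (subst (All (1 ≤_)) legs≡ positive)
    ... | pos-pre , (_ ∷ pos-post) = Allₚ.++⁺ pos-pre pos-post

    two-others : 2 ≤ length others
    two-others = ℕₚ.≤-pred (ℕₚ.≤-trans (proj₁ spider) (ℕₚ.≤-reflexive (trans (cong length legs≡)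
      (trans (Listₚ.length-++ pre) (trans (ℕₚ.+-suc (length pre) (length post)) (cong suc (sym (Listₚ.length-++ pre))))))))

    others<t₀ : All (_< t₀) others
    others<t₀ = parts<sum others-positive two-others

    1≤t₀ : 1 ≤ t₀
    1≤t₀ with others | others-positive | two-others
    ... | x ∷ l | 1≤x ∷ _ | _ = ℕₚ.≤-trans 1≤x (ℕₚ.m≤m+n x (sum l))

    t₀<m : t₀ < m
    t₀<m = ℕₚ.+-cancelˡ-≤ m (suc t₀) m (ℕₚ.≤-trans (ℕₚ.≤-reflexive (ℕₚ.+-suc m t₀))
      (ℕₚ.≤-pred (ℕₚ.≤-trans (s≤s (ℕₚ.+-monoˡ-≤ t₀ m<L)) (ℕₚ.≤-trans (ℕₚ.≤-reflexive (sym n≡)) n≤2m+1))))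

    t₀<L : t₀ < L
    t₀<L = ℕₚ.<-trans t₀<m m<L

    count-middle : ∀ {j} → t₀ ≤ j → j ≤ L → count j ≡ 1
    count-middle {j} t₀≤j j≤L rewrite count-split j | ≤ᵇ-true j≤L =
      cong suc (countAtLeast-<-zero j (All.map (λ x<t₀ → ℕₚ.<-≤-trans x<t₀ t₀≤j) others<t₀))

    count-beyond : ∀ {j} → L < j → count j ≡ 0
    count-beyond {j} L<j rewrite count-split j | ≤ᵇ-false (ℕₚ.<⇒≱ L<j) =
      countAtLeast-<-zero j (All.map (λ x<t₀ → ℕₚ.<-trans x<t₀ (ℕₚ.<-trans t₀<L L<j)) others<t₀)

    D-low : ∀ {a} → a ≤ t₀ → D a ≡ count a
    D-low {a} a≤t₀ = D-no-complement a (count-beyond (ℕₚ.+-cancelˡ-≤ a (suc L) (n ∸ a) (ℕₚ.≤-trans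
      (ℕₚ.≤-reflexive (ℕₚ.+-suc a L)) (ℕₚ.≤-trans (s≤s (ℕₚ.≤-trans (ℕₚ.≤-reflexive (ℕₚ.+-comm a L)) (ℕₚ.+-monoʳ-≤ L a≤t₀)))
        (ℕₚ.≤-reflexive (trans (sym n≡) (sym (a+[n∸a]≡n (ℕₚ.<⇒≤ (ℕₚ.≤-<-trans a≤t₀ t₀<m))))))))))

    D-high : ∀ {a} → t₀ < a → a ≤ m → (a ≡ n ∸ a × D a ≡ 1) ⊎ (¬ a ≡ n ∸ a × D a ≡ 2)
    D-high {a} t₀<a a≤m with a ≟ n ∸ a
    ... | yes a≡ = inj₁ (a≡ , trans (D-≡ a≡) count-a)
      where
      count-a = count-middle (ℕₚ.<⇒≤ t₀<a) (ℕₚ.≤-trans a≤m (ℕₚ.<⇒≤ m<L))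
    ... | no a≢ = inj₂ (a≢ , trans (D-≢ a≢) (cong₂ ℕ._+_ (count-middle (ℕₚ.<⇒≤ t₀<a) (ℕₚ.≤-trans a≤m (ℕₚ.<⇒≤ m<L)))
                                                          (count-middle (ℕₚ.≤-trans (ℕₚ.<⇒≤ t₀<a) (a≤n∸a a≤m)) n∸a≤L)))
      where
      n∸a≤L : n ∸ a ≤ L
      n∸a≤L = ℕₚ.+-cancelˡ-≤ a (n ∸ a) L (ℕₚ.≤-trans (ℕₚ.≤-reflexive (trans (a+[n∸a]≡n a≤m) n≡))
        (ℕₚ.≤-trans (ℕₚ.≤-reflexive (sym (ℕₚ.+-suc L t₀))) (ℕₚ.≤-trans (ℕₚ.+-monoʳ-≤ L t₀<a) (ℕₚ.≤-reflexive (ℕₚ.+-comm L a)))))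

    D-t₀ : D t₀ ≡ 1
    D-t₀ = trans (D-low ℕₚ.≤-refl) (count-middle ℕₚ.≤-refl (ℕₚ.<⇒≤ t₀<L))

    -- If t₀ + 1 = n - (t₀ + 1) then n = 2 (t₀ + 1), forcing L = t₀ + 1 ≤ m.
    D-after-t₀ : D (suc t₀) ≡ 2
    D-after-t₀ with D-high (ℕₚ.n<1+n t₀) t₀<m
    ... | inj₂ (_ , D≡2) = D≡2
    ... | inj₁ (a≡ , _) = ⊥-elim (ℕₚ.<⇒≱ m<L (ℕₚ.≤-trans (ℕₚ.≤-reflexive L≡) t₀<m))
      where
      L≡ : L ≡ suc t₀
      L≡ = ℕₚ.+-cancelʳ-≡ t₀ L (suc t₀) (ℕₚ.suc-injective (begin
        suc (L ℕ.+ t₀)              ≡⟨ n≡ ⟨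
        n                           ≡⟨ a+[n∸a]≡n t₀<m ⟨
        suc t₀ ℕ.+ (n ∸ suc t₀)     ≡⟨ cong (suc t₀ ℕ.+_) a≡ ⟨
        suc t₀ ℕ.+ suc t₀           ≡⟨ cong suc (ℕₚ.+-comm t₀ (suc t₀)) ⟩
        suc (suc t₀ ℕ.+ t₀)         ∎))
        where open ≡-Reasoning

  2≰1 : ¬ 2 ≤ 1
  2≰1 = ℕₚ.<⇒≱ (ℕₚ.n<1+n 1)

  module _ (d : ℕ → ℕ) (d≡D : ∀ {a} → 1 ≤ a → a ≤ m → d a ≡ D a) where

    module ShortLegs (short : All (_≤ m) legs) where
      open NoLongLeg short

      d≡count : ∀ {a} → 1 ≤ a → a ≤ m → d a ≡ count a
      d≡count 1≤a a≤m = trans (d≡D 1≤a a≤m) (D≡count a≤m)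

      case1 : Case1 m d
      case1 i j 1≤i i≤j j≤m = subst₂ _≤_ (sym (d≡count (ℕₚ.≤-trans 1≤i i≤j) j≤m)) (sym (d≡count 1≤i (ℕₚ.≤-trans i≤j j≤m)))
        (countAtLeast-anti legs i≤j)

      case1-↭ : legs ↭ conjugate (mu1 m d)
      case1-↭ rewrite mu1-prefixShape m d = ↭-prefixShape d m 0 m (ℕₚ.+-identityʳ m) positive
        (prefixShape-desc d m 0 case1 (inj₁ refl))
        (λ i i<m → sym (d≡count (s≤s z≤n) i<m))
        (λ i m≤i i<m → ⊥-elim (ℕₚ.<⇒≱ i<m m≤i))
        (λ i m≤i → count-beyond (s≤s m≤i))

      case2-↭ : ∀ t → Case2 m d t → legs ↭ conjugate (mu2 m d t)
      case2-↭ t (1≤t , t≤m , antitone , dt≡1 , twos , dm) =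
        subst (λ μ → legs ↭ conjugate μ) (sym (mu2-prefixShape m d t t≤m one-or-two))
          (↭-prefixShape d t R m t+R≡m positive (prefixShape-desc d t R antitone (inj₂ (ℕₚ.≤-reflexive (sym dt≡1))))
          (λ i i<t → sym (d≡count (s≤s z≤n) (ℕₚ.≤-trans i<t t≤m)))
          (λ i t≤i i<m → subst (λ k → count k ≡ 1) (ℕₚ.≤-antisym (ℕₚ.≤-trans m≤1+t (s≤s t≤i)) i<m)
                                (count-m (ℕₚ.≤-<-trans t≤i i<m)))
          (λ i m≤i → count-beyond (s≤s m≤i)))
        where
        R = tailSum d t (m ∸ t)
        count-t : count t ≡ 1
        count-t = trans (sym (d≡count 1≤t t≤m)) dt≡1
        at-most-one : ∀ {a} → t ≤ a → a ≤ m → d a ≤ 1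
        at-most-one t≤a a≤m = subst (_≤ 1) (sym (d≡count (ℕₚ.≤-trans 1≤t t≤a) a≤m))
          (subst (count _ ≤_) count-t (countAtLeast-anti legs t≤a))
        one-or-two : ∀ i → t < i → i ≤ m → d i ≡ 1 ⊎ d i ≡ 2
        one-or-two i t<i i≤m with ℕₚ.m≤n⇒m<n∨m≡n i≤m
        ... | inj₁ i<m = inj₂ (twos i t<i i<m)
        ... | inj₂ refl = dm
        m≤1+t : m ≤ suc t
        m≤1+t with m ≤? suc t
        ... | yes m≤ = m≤
        ... | no m≰ = ⊥-elim (2≰1 (subst (_≤ 1) (twos (suc t) (ℕₚ.n<1+n t) (ℕₚ.≰⇒> m≰))
                                     (at-most-one (ℕₚ.n≤1+n t) (ℕₚ.<⇒≤ (ℕₚ.≰⇒> m≰)))))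
        count-m : t < m → count m ≡ 1
        count-m t<m = from-dm dm
          where
          from-dm : d m ≡ 1 ⊎ d m ≡ 2 → count m ≡ 1
          from-dm (inj₁ dm≡1) = trans (sym (d≡count (ℕₚ.≤-trans 1≤t t≤m) ℕₚ.≤-refl)) dm≡1
          from-dm (inj₂ dm≡2) = ⊥-elim (2≰1 (subst (_≤ 1) dm≡2 (at-most-one (ℕₚ.<⇒≤ t<m) ℕₚ.≤-refl)))
        t+R≡m : t ℕ.+ R ≡ m
        t+R≡m with ℕₚ.m≤n⇒m<n∨m≡n t≤m
        ... | inj₂ refl rewrite ℕₚ.n∸n≡0 t = ℕₚ.+-identityʳ t
        ... | inj₁ t<m = begin
          t ℕ.+ tailSum d t (m ∸ t)   ≡⟨ cong (λ k → t ℕ.+ tailSum d t (k ∸ t)) m≡1+t ⟩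
          t ℕ.+ tailSum d t (1 ℕ.+ t ∸ t) ≡⟨ cong (λ k → t ℕ.+ tailSum d t k) (ℕₚ.m+n∸n≡m 1 t) ⟩
          t ℕ.+ d (t ℕ.+ 1)           ≡⟨ cong (t ℕ.+_) (trans (cong d (trans (ℕₚ.+-comm t 1) (sym m≡1+t)))
                                                        (trans (d≡count (ℕₚ.≤-trans 1≤t t≤m) ℕₚ.≤-refl) (count-m t<m))) ⟩
          t ℕ.+ 1                     ≡⟨ trans (ℕₚ.+-comm t 1) (sym m≡1+t) ⟩
          m                           ∎
          where
          open ≡-Reasoning
          m≡1+t : m ≡ suc t
          m≡1+t = ℕₚ.≤-antisym m≤1+t t<m

    module WithLongLeg (pre : List ℕ) (L : ℕ) (post : List ℕ) (legs≡ : legs ≡ pre ++ L ∷ post) (m<L : m < L) where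
      open LongLeg pre L post legs≡ m<L

      d-t₀ : d t₀ ≡ 1
      d-t₀ = trans (d≡D 1≤t₀ (ℕₚ.<⇒≤ t₀<m)) D-t₀

      d-after-t₀ : d (suc t₀) ≡ 2
      d-after-t₀ = trans (d≡D (s≤s z≤n) t₀<m) D-after-t₀

      d-low : ∀ {a} → 1 ≤ a → a ≤ t₀ → d a ≡ count a
      d-low 1≤a a≤t₀ = trans (d≡D 1≤a (ℕₚ.≤-trans a≤t₀ (ℕₚ.<⇒≤ t₀<m))) (D-low a≤t₀)

      d-twos : ∀ i → t₀ < i → i < m → d i ≡ 2
      d-twos i t₀<i i<m with D-high t₀<i (ℕₚ.<⇒≤ i<m)
      ... | inj₁ (i≡ , _) = ⊥-elim (ℕₚ.<-irrefl (self-complementary (ℕₚ.<⇒≤ i<m) i≡) i<m)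
      ... | inj₂ (_ , D≡2) = trans (d≡D (ℕₚ.≤-trans (s≤s z≤n) t₀<i) (ℕₚ.<⇒≤ i<m)) D≡2

      d-m : d m ≡ 1 ⊎ d m ≡ 2
      d-m with D-high t₀<m ℕₚ.≤-refl
      ... | inj₁ (_ , D≡1) = inj₁ (trans (d≡D (ℕₚ.≤-trans (s≤s z≤n) t₀<m) ℕₚ.≤-refl) D≡1)
      ... | inj₂ (_ , D≡2) = inj₂ (trans (d≡D (ℕₚ.≤-trans (s≤s z≤n) t₀<m) ℕₚ.≤-refl) D≡2)

      antitone : ∀ i j → 1 ≤ i → i ≤ j → j ≤ t₀ → d j ≤ d i
      antitone i j 1≤i i≤j j≤t₀ = subst₂ _≤_ (sym (d-low (ℕₚ.≤-trans 1≤i i≤j) j≤t₀)) (sym (d-low 1≤i (ℕₚ.≤-trans i≤j j≤t₀)))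
        (countAtLeast-anti legs i≤j)

      case2 : Case2 m d t₀
      case2 = 1≤t₀ , ℕₚ.<⇒≤ t₀<m , antitone , d-t₀ , d-twos , d-m

      not-case1 : ¬ Case1 m d
      not-case1 case1 = 2≰1 (subst₂ _≤_ d-after-t₀ d-t₀ (case1 t₀ (suc t₀) 1≤t₀ (ℕₚ.n≤1+n t₀) t₀<m))

      case2-unique : ∀ {t} → Case2 m d t → t ≡ t₀
      case2-unique {t} (_ , _ , antitone′ , dt≡1 , twos , _) with ℕₚ.<-cmp t t₀
      ... | tri< t<t₀ _ _ = ⊥-elim (2≰1 (ℕₚ.≤-reflexive (trans (sym (twos t₀ t<t₀ t₀<m)) d-t₀)))
      ... | tri≈ _ t≡t₀ _ = t≡t₀
      ... | tri> _ _ t₀<t = ⊥-elim (2≰1 (subst₂ _≤_ d-after-t₀ d-t₀ (antitone′ t₀ (suc t₀) 1≤t₀ (ℕₚ.n≤1+n t₀) t₀<t)))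

      -- The entries after t₀ are 2 except possibly the last (1 when n = 2m, 2 when n = 2m + 1),
      -- and together they account for L - t₀ parts 1.
      tail-length : t₀ ℕ.+ tailSum d t₀ (m ∸ t₀) ≡ L
      tail-length = begin
        t₀ ℕ.+ tailSum d t₀ (m ∸ t₀)                   ≡⟨ cong (λ j → t₀ ℕ.+ tailSum d t₀ j) m∸t₀≡1+k ⟩
        t₀ ℕ.+ (tailSum d t₀ k ℕ.+ d (t₀ ℕ.+ suc k))   ≡⟨ cong (λ s → t₀ ℕ.+ (s ℕ.+ d (t₀ ℕ.+ suc k)))
                                                            (twos-sum k (ℕₚ.<-≤-trans (ℕₚ.+-monoʳ-< t₀ (ℕₚ.n<1+n k))
                                                                                      (ℕₚ.≤-reflexive t₀+1+k≡m))) ⟩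
        t₀ ℕ.+ (k ℕ.+ k ℕ.+ d (t₀ ℕ.+ suc k))          ≡⟨ cong (λ j → t₀ ℕ.+ (k ℕ.+ k ℕ.+ d j)) t₀+1+k≡m ⟩
        t₀ ℕ.+ (k ℕ.+ k ℕ.+ d m)                        ≡⟨ last-entry ⟩
        L ∎
        where
        open ≡-Reasoning
        k = m ∸ suc t₀
        t₀+1+k≡m : t₀ ℕ.+ suc k ≡ m
        t₀+1+k≡m = trans (ℕₚ.+-suc t₀ k) (ℕₚ.m+[n∸m]≡n t₀<m)
        m∸t₀≡1+k : m ∸ t₀ ≡ suc k
        m∸t₀≡1+k = trans (cong (_∸ t₀) (sym t₀+1+k≡m)) (ℕₚ.m+n∸m≡n t₀ (suc k))
        twos-sum : ∀ j → t₀ ℕ.+ j < m → tailSum d t₀ j ≡ j ℕ.+ j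
        twos-sum zero _ = refl
        twos-sum (suc j) t₀+1+j<m = trans (cong₂ ℕ._+_ (twos-sum j (ℕₚ.<-trans (ℕₚ.+-monoʳ-< t₀ (ℕₚ.n<1+n j)) t₀+1+j<m))
                                                    (d-twos (t₀ ℕ.+ suc j) (ℕₚ.m<m+n t₀ (s≤s z≤n)) t₀+1+j<m)) (double-suc j)
          where
          double-suc : ∀ j → j ℕ.+ j ℕ.+ 2 ≡ suc j ℕ.+ suc j
          double-suc = solve-∀ℕ
        L-from-n : ∀ e → n ≡ e ℕ.+ (m ℕ.+ m) → t₀ ℕ.+ (k ℕ.+ k ℕ.+ suc e) ≡ L
        L-from-n e n≡e+2m = sym (ℕₚ.+-cancelʳ-≡ t₀ L _ (ℕₚ.suc-injective (begin
          suc (L ℕ.+ t₀)                                  ≡⟨ n≡ ⟨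
          n                                               ≡⟨ n≡e+2m ⟩
          e ℕ.+ (m ℕ.+ m)                                 ≡⟨ cong (λ j → e ℕ.+ (j ℕ.+ j)) t₀+1+k≡m ⟨
          e ℕ.+ ((t₀ ℕ.+ suc k) ℕ.+ (t₀ ℕ.+ suc k))       ≡⟨ regroup e t₀ k ⟩
          suc (t₀ ℕ.+ (k ℕ.+ k ℕ.+ suc e) ℕ.+ t₀)         ∎)))
          where
          regroup : ∀ e t k → e ℕ.+ ((t ℕ.+ suc k) ℕ.+ (t ℕ.+ suc k)) ≡ suc (t ℕ.+ (k ℕ.+ k ℕ.+ suc e) ℕ.+ t)
          regroup = solve-∀ℕ
        last-entry : t₀ ℕ.+ (k ℕ.+ k ℕ.+ d m) ≡ L
        last-entry with D-high t₀<m ℕₚ.≤-refl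
        ... | inj₁ (m≡n∸m , D≡1) rewrite d≡D (ℕₚ.≤-trans (s≤s z≤n) t₀<m) ℕₚ.≤-refl | D≡1 =
          L-from-n 0 (trans (sym (a+[n∸a]≡n ℕₚ.≤-refl)) (cong (m ℕ.+_) (sym m≡n∸m)))
        ... | inj₂ (m≢n∸m , D≡2) rewrite d≡D (ℕₚ.≤-trans (s≤s z≤n) t₀<m) ℕₚ.≤-refl | D≡2 with parity
        ...   | inj₂ n≡1+2m = L-from-n 1 n≡1+2m
        ...   | inj₁ n≡2m = ⊥-elim (m≢n∸m (sym (trans (cong (_∸ m) n≡2m) (ℕₚ.m+n∸m≡n m m))))

      case2-↭ : legs ↭ conjugate (mu2 m d t₀)
      case2-↭ = subst (λ μ → legs ↭ conjugate μ) (sym (mu2-prefixShape m d t₀ (ℕₚ.<⇒≤ t₀<m) one-or-two))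
        (↭-prefixShape d t₀ (tailSum d t₀ (m ∸ t₀)) L tail-length positive
          (prefixShape-desc d t₀ _ antitone (inj₂ (ℕₚ.≤-reflexive (sym d-t₀))))
          (λ i i<t₀ → sym (d-low (s≤s z≤n) i<t₀))
          (λ i t₀≤i i<L → count-middle (ℕₚ.m≤n⇒m≤1+n t₀≤i) i<L)
          (λ i L≤i → count-beyond (s≤s L≤i)))
        where
        one-or-two : ∀ i → t₀ < i → i ≤ m → d i ≡ 1 ⊎ d i ≡ 2
        one-or-two i t₀<i i≤m with ℕₚ.m≤n⇒m<n∨m≡n i≤m
        ... | inj₁ i<m = inj₂ (d-twos i t₀<i i<m)
        ... | inj₂ refl = d-m

    shape : (Case1 m d ⊎ Σ ℕ (λ t → Case2 m d t))
            × (Case1 m d → legs ↭ conjugate (mu1 m d))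
            × ((t : ℕ) → Case2 m d t → legs ↭ conjugate (mu2 m d t))
    shape with any? (m <?_) legs
    ... | no no-long = inj₁ case1 , (λ _ → case1-↭) , case2-↭
      where open ShortLegs (All.map ℕₚ.≮⇒≥ (Allₚ.¬Any⇒All¬ legs no-long))
    ... | yes long with find long
    ... | L , L∈legs , m<L with ∈-∃++ L∈legs
    ... | pre , post , legs≡ = inj₂ (t₀ , case2) , (⊥-elim ∘ not-case1) ,
          (λ t c2 → subst (λ t → legs ↭ conjugate (mu2 m d t)) (sym (case2-unique c2)) case2-↭)
      where
      open LongLeg pre L post legs≡ m<L using (t₀)
      open WithLongLeg pre L post legs≡ m<L

theorem3p2 : (legs : List ℕ) → IsSpiderLegs legs →
    let n = order legs
        E = spiderEdges legs
        m = n / 2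
    in (Σ (List ℕ → ℤ) (λ c → IsPowerSumExpansion n E c))
       × ((c : List ℕ → ℤ) → IsPowerSumExpansion n E c →
           let d = dval n c
           in (Case1 m d ⊎ Σ ℕ (λ t → Case2 m d t))
              × (Case1 m d → legs ↭ conjugate (mu1 m d))
              × ((t : ℕ) → Case2 m d t → legs ↭ conjugate (mu2 m d t)))
theorem3p2 legs spider =
  (coefficients , coefficients-expansion) ,
  λ c expansion → shape (dval (order legs) c) (λ {a} 1≤a a≤m → dval-spider c expansion a 1≤a (a≤n∸a a≤m))
  where
  open SpiderExpansion legs
  open LegCounts legs spider
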